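{- Let $T$ be a tournament of odd order $n\ge 5$ and let $c_5(T)$ be the number of directed cycles of length $5$ in $T$. Then $$c_5(T)\le \frac{(n+1)n(n-1)(n-2)(n-3)}{160},$$ with equality if and only if $T$ is doubly regular.
   Context: A tournament of order $n$ is an orientation of the complete graph $K_n$. A directed $5$-cycle is a sequence of 5 distinct vertices $v_1\to v_2\to v_3\to v_4\to v_5\to v_1$, counted up to cyclic shift. A tournament of order $n$ is doubly regular if it is regular (every vertex has out-degree $\frac{n-1}{2}$) and every two distinct vertices jointly dominate exactly $\frac{n-3}{4}$ vertices (equivalently, the out-set of each vertex induces a regular tournament); this forces $n\equiv 3\pmod 4$. -}

module Defs where

open import Data.Nat using (ℕ; _+_; _*_)
open import Data.Bool using (Bool; true; false; not; _∧_; if_then_else_)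
open import Data.Fin using (Fin) renaming (_<?_ to _<ᶠ?_; _≟_ to _≟ᶠ_)
open import Data.List using (allFin; map)
open import Data.Nat.ListAction using (sum)
open import Relation.Nullary using (¬_; does)
open import Relation.Binary.PropositionalEquality using (_≡_)

-- A tournament on the vertex set Fin n: out i j = true means the arc i → j.
-- No loops, and for distinct i, j exactly one of i → j, j → i.
record Tournament (n : ℕ) : Set where
  field
    out    : Fin n → Fin n → Bool
    irrefl : ∀ i → out i i ≡ false
    tourn  : ∀ i j → ¬ (i ≡ j) → out i j ≡ not (out j i)
open Tournament public

sumFin : ∀ {n} → (Fin n → ℕ) → ℕ
sumFin {n} f = sum (map f (allFin n))

countFin : ∀ {n} → (Fin n → Bool) → ℕ
countFin p = sumFin (λ i → if p i then 1 else 0)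

neq : ∀ {n} → Fin n → Fin n → Bool
neq i j = not (does (i ≟ᶠ j))

lt : ∀ {n} → Fin n → Fin n → Bool
lt i j = does (i <ᶠ? j)

-- (a,b,c,d,e) is a directed 5-cycle a→b→c→d→e→a written in its canonical
-- cyclic rotation: a is the smallest of the five (distinct) vertices.
-- Each directed 5-cycle (up to cyclic shift) has exactly one such rotation.
isCanonical5Cycle : ∀ {n} → Tournament n → Fin n → Fin n → Fin n → Fin n → Fin n → Bool
isCanonical5Cycle T a b c d e =
  lt a b ∧ lt a c ∧ lt a d ∧ lt a e ∧
  neq b c ∧ neq b d ∧ neq b e ∧ neq c d ∧ neq c e ∧ neq d e ∧
  out T a b ∧ out T b c ∧ out T c d ∧ out T d e ∧ out T e a

c5 : ∀ {n} → Tournament n → ℕ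
c5 T = sumFin λ a → sumFin λ b → sumFin λ c → sumFin λ d →
         countFin λ e → isCanonical5Cycle T a b c d e

outdeg : ∀ {n} → Tournament n → Fin n → ℕ
outdeg T v = countFin (out T v)

jointOut : ∀ {n} → Tournament n → Fin n → Fin n → ℕ
jointOut T u v = countFin (λ w → out T u w ∧ out T v w)

IsRegular : ∀ {n} → Tournament n → Set
IsRegular {n} T = ∀ v → 2 * outdeg T v + 1 ≡ n

-- doubly regular: regular and every two distinct vertices jointly dominate
-- exactly (n-3)/4 vertices, i.e. 4·jointOut + 3 = n
IsDoublyRegular : ∀ {n} → Tournament n → Set
IsDoublyRegular {n} T =
  IsRegular T × (∀ u v → ¬ (u ≡ v) → 4 * jointOut T u v + 3 ≡ n)
  where open import Data.Product using (_×_)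

-- Write A for the adjacency matrix of T and S = A - Aᵀ for its skew-symmetric ±1 matrix, so that
-- 2A = J + R with R = S - I.  In a tournament every closed walk of length five is a directed
-- 5-cycle, so 5·c₅ = tr A⁵ and 160·c₅ = tr (J + R)⁵.  Expanding, every term is a walk count
-- 𝟏ᵀRᵏ𝟏 or tr R⁵; writing R = S - I binomially, all odd moments of the skew matrix S vanish and
-- what remains is n, σ = ‖s‖², τ = ‖Ss‖² (s = S𝟏 the score deviations) and ‖S²‖²:
--   160·c₅ = (n+1)n(n-1)(n-2)(n-3) - 5D,
--   2D = (n-3)(n-4)σ + (n(n-1)σ - 2τ) + 2(‖S²‖² - n²(n-1)).
-- Bessel's inequality for the rows of S against the orthogonal pair s, Ss, together with
-- Cauchy–Schwarz for S²s against s, gives n(n-1)σ ≥ 2τ.  For odd n the off-diagonal entries of S²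
-- are odd, whence ‖S²‖² ≥ n²(n-1).  So D ≥ 0, and D = 0 forces s = 0 (regularity) and S²ᵤᵥ = 1
-- off the diagonal, which by S²ᵤᵥ + 4·|N⁺(u) ∩ N⁺(v)| = sᵤ + sᵥ + n - 2 is double regularity.

module Submission where

module FiniteSums where

  open import Data.Nat.Base as ℕ using (zero; suc)
  open import Data.Fin.Base using (Fin; zero; suc)
  open import Data.Integer.Base hiding (suc)
  open import Data.Integer.Properties
  open import Data.Integer.Tactic.RingSolver using (solve-∀)
  open import Data.Product.Base using (_×_; _,_)
  open import Function.Base using (_∘_)
  open import Relation.Binary.PropositionalEquality
  open import Relation.Nullary using (¬_)
  open import Relation.Nullary.Negation using (contradiction)

  open import Algebra.Properties.Semiring.Sum +-*-semiring public
    using (sum; sum-syntax; sum-cong-≗; ∑-distrib-+; ∑-comm; *-distribˡ-sum; *-distribʳ-sum; sum-replicate-zero)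

  ∑-const : ∀ n c → ∑[ i < n ] c ≡ + n * c
  ∑-const zero    c = refl
  ∑-const (suc n) c = begin
    c + ∑[ i < n ] c     ≡⟨ cong (_+_ c) (∑-const n c) ⟩
    c + + n * c          ≡⟨ cong (_+ + n * c) (*-identityˡ c) ⟨
    1ℤ * c + + n * c     ≡⟨ *-distribʳ-+ c 1ℤ (+ n) ⟨
    (1ℤ + + n) * c       ≡⟨ cong (_* c) (pos-+ 1 n) ⟨
    + suc n * c          ∎
    where open ≡-Reasoning

  ∑-split : ∀ {n} {h f g : Fin n → ℤ} → (∀ i → h i ≡ f i + g i) → ∑[ i < n ] h i ≡ ∑[ i < n ] f i + ∑[ i < n ] g i
  ∑-split {f = f} {g} h≡f+g = trans (sum-cong-≗ h≡f+g) (∑-distrib-+ f g)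

  ∑-*ˡ : ∀ {n} x (f : Fin n → ℤ) → ∑[ i < n ] (x * f i) ≡ x * ∑[ i < n ] f i
  ∑-*ˡ x f = sym (*-distribˡ-sum x f)

  ∑-*ʳ : ∀ {n} x (f : Fin n → ℤ) → ∑[ i < n ] (f i * x) ≡ ∑[ i < n ] f i * x
  ∑-*ʳ x f = sym (*-distribʳ-sum x f)

  ∑²-*ˡ : ∀ {n} x (f : Fin n → Fin n → ℤ) → ∑[ i < n ] ∑[ j < n ] (x * f i j) ≡ x * ∑[ i < n ] ∑[ j < n ] f i j
  ∑²-*ˡ {n} x f = trans (sum-cong-≗ λ i → ∑-*ˡ x (f i)) (∑-*ˡ x λ i → ∑[ j < n ] f i j)

  ∑³-*ˡ : ∀ {n} x (f : Fin n → Fin n → Fin n → ℤ) →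
          ∑[ i < n ] ∑[ j < n ] ∑[ k < n ] (x * f i j k) ≡ x * ∑[ i < n ] ∑[ j < n ] ∑[ k < n ] f i j k
  ∑³-*ˡ {n} x f = trans (sum-cong-≗ λ i → ∑²-*ˡ x (f i)) (∑-*ˡ x λ i → ∑[ j < n ] ∑[ k < n ] f i j k)

  ∑²-*ʳ : ∀ {n} x (f : Fin n → Fin n → ℤ) → ∑[ i < n ] ∑[ j < n ] (f i j * x) ≡ (∑[ i < n ] ∑[ j < n ] f i j) * x
  ∑²-*ʳ {n} x f = trans (sum-cong-≗ λ i → ∑-*ʳ x (f i)) (∑-*ʳ x λ i → ∑[ j < n ] f i j)

  ∑³-*ʳ : ∀ {n} x (f : Fin n → Fin n → Fin n → ℤ) →
          ∑[ i < n ] ∑[ j < n ] ∑[ k < n ] (f i j k * x) ≡ (∑[ i < n ] ∑[ j < n ] ∑[ k < n ] f i j k) * x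
  ∑³-*ʳ {n} x f = trans (sum-cong-≗ λ i → ∑²-*ʳ x (f i)) (∑-*ʳ x λ i → ∑[ j < n ] ∑[ k < n ] f i j k)

  ∑⁴-*ˡ : ∀ {n} x (f : Fin n → Fin n → Fin n → Fin n → ℤ) →
          ∑[ i < n ] ∑[ j < n ] ∑[ k < n ] ∑[ l < n ] (x * f i j k l) ≡ x * ∑[ i < n ] ∑[ j < n ] ∑[ k < n ] ∑[ l < n ] f i j k l
  ∑⁴-*ˡ {n} x f = trans (sum-cong-≗ λ i → ∑³-*ˡ x (f i)) (∑-*ˡ x λ i → ∑[ j < n ] ∑[ k < n ] ∑[ l < n ] f i j k l)

  ∑-distrib-+⁶ : ∀ {n} (f₁ f₂ f₃ f₄ f₅ f₆ : Fin n → ℤ) →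
    ∑[ i < n ] (f₁ i + f₂ i + f₃ i + f₄ i + f₅ i + f₆ i)
    ≡ sum f₁ + sum f₂ + sum f₃ + sum f₄ + sum f₅ + sum f₆
  ∑-distrib-+⁶ f₁ f₂ f₃ f₄ f₅ f₆ =
    trans (∑-distrib-+ (λ i → f₁ i + f₂ i + f₃ i + f₄ i + f₅ i) f₆) (cong (_+ sum f₆)
    (trans (∑-distrib-+ (λ i → f₁ i + f₂ i + f₃ i + f₄ i) f₅) (cong (_+ sum f₅)
    (trans (∑-distrib-+ (λ i → f₁ i + f₂ i + f₃ i) f₄) (cong (_+ sum f₄)
    (trans (∑-distrib-+ (λ i → f₁ i + f₂ i) f₃) (cong (_+ sum f₃) (∑-distrib-+ f₁ f₂))))))))

  ∑-neg : ∀ {n} (f : Fin n → ℤ) → ∑[ i < n ] (- f i) ≡ - ∑[ i < n ] f i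
  ∑-neg {zero}  f = refl
  ∑-neg {suc n} f = begin
    - f zero + ∑[ i < n ] (- f (suc i))  ≡⟨ cong (_+_ (- f zero)) (∑-neg (f ∘ suc)) ⟩
    - f zero + - ∑[ i < n ] f (suc i)    ≡⟨ neg-distrib-+ (f zero) _ ⟨
    - (f zero + ∑[ i < n ] f (suc i))    ∎
    where open ≡-Reasoning

  ∑-distrib-sub : ∀ {n} (f g : Fin n → ℤ) → ∑[ i < n ] (f i - g i) ≡ ∑[ i < n ] f i - ∑[ i < n ] g i
  ∑-distrib-sub f g = trans (∑-distrib-+ f (λ i → - g i)) (cong (_+_ (sum f)) (∑-neg g))

  δ : ∀ {n} → Fin n → Fin n → ℤ
  δ zero    zero    = 1ℤ
  δ zero    (suc j) = 0ℤ
  δ (suc i) zero    = 0ℤ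
  δ (suc i) (suc j) = δ i j

  δ-refl : ∀ {n} (i : Fin n) → δ i i ≡ 1ℤ
  δ-refl zero    = refl
  δ-refl (suc i) = δ-refl i

  δ-≢ : ∀ {n} {i j : Fin n} → ¬ i ≡ j → δ i j ≡ 0ℤ
  δ-≢ {i = zero}  {zero}  i≢j = contradiction refl i≢j
  δ-≢ {i = zero}  {suc j} i≢j = refl
  δ-≢ {i = suc i} {zero}  i≢j = refl
  δ-≢ {i = suc i} {suc j} i≢j = δ-≢ (i≢j ∘ cong suc)

  δ-sym : ∀ {n} (i j : Fin n) → δ i j ≡ δ j i
  δ-sym zero    zero    = refl
  δ-sym zero    (suc j) = refl
  δ-sym (suc i) zero    = refl
  δ-sym (suc i) (suc j) = δ-sym i j

  ∑-zero : ∀ n → ∑[ i < n ] 0ℤ ≡ 0ℤ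
  ∑-zero = sum-replicate-zero

  ∑-δ : ∀ {n} (i : Fin n) (f : Fin n → ℤ) → ∑[ j < n ] (δ i j * f j) ≡ f i
  ∑-δ {suc n} zero f = begin
    1ℤ * f zero + ∑[ j < n ] (0ℤ * f (suc j))  ≡⟨ cong₂ _+_ (*-identityˡ (f zero)) (sum-cong-≗ (λ j → *-zeroˡ (f (suc j)))) ⟩
    f zero + ∑[ j < n ] 0ℤ                   ≡⟨ cong (_+_ (f zero)) (∑-zero n) ⟩
    f zero + 0ℤ                              ≡⟨ +-identityʳ (f zero) ⟩
    f zero                                   ∎
    where open ≡-Reasoning
  ∑-δ {suc n} (suc i) f = trans (+-identityˡ _) (∑-δ i (f ∘ suc))

  ∑-δʳ : ∀ {n} (i : Fin n) (f : Fin n → ℤ) → ∑[ j < n ] (f j * δ i j) ≡ f i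
  ∑-δʳ i f = trans (sum-cong-≗ λ j → *-comm (f j) (δ i j)) (∑-δ i f)

  ∑-*-offDiagonal : ∀ {n} (i : Fin n) (f : Fin n → ℤ) → ∑[ j < n ] (f j * (1ℤ - δ i j)) ≡ ∑[ j < n ] f j - f i
  ∑-*-offDiagonal {n} i f = begin
    ∑[ j < n ] (f j * (1ℤ - δ i j))             ≡⟨ sum-cong-≗ (λ j → ring (f j) (δ i j)) ⟩
    ∑[ j < n ] (f j - f j * δ i j)              ≡⟨ ∑-distrib-sub f (λ j → f j * δ i j) ⟩
    ∑[ j < n ] f j - ∑[ j < n ] (f j * δ i j)   ≡⟨ cong (_-_ (sum f)) (∑-δʳ i f) ⟩
    ∑[ j < n ] f j - f i                        ∎
    where
    open ≡-Reasoning
    ring : ∀ x d → x * (1ℤ - d) ≡ x - x * d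
    ring = solve-∀

  ∑-offDiagonal : ∀ {n} (i : Fin n) → ∑[ j < n ] (1ℤ - δ i j) ≡ + n - 1ℤ
  ∑-offDiagonal {n} i = begin
    ∑[ j < n ] (1ℤ - δ i j)              ≡⟨ ∑-distrib-sub (λ _ → 1ℤ) (δ i) ⟩
    ∑[ j < n ] 1ℤ - ∑[ j < n ] δ i j     ≡⟨ cong₂ _-_ (trans (∑-const n 1ℤ) (*-identityʳ (+ n))) ∑δ≡1 ⟩
    + n - 1ℤ                             ∎
    where
    open ≡-Reasoning
    ∑δ≡1 : ∑[ j < n ] δ i j ≡ 1ℤ
    ∑δ≡1 = trans (sum-cong-≗ λ j → sym (*-identityʳ (δ i j))) (∑-δ i (λ _ → 1ℤ))

  ∑-nonneg : ∀ {n} (f : Fin n → ℤ) → (∀ i → 0ℤ ≤ f i) → 0ℤ ≤ ∑[ i < n ] f i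
  ∑-nonneg {zero}  f f≥0 = ≤-refl
  ∑-nonneg {suc n} f f≥0 = +-mono-≤ (f≥0 zero) (∑-nonneg (f ∘ suc) (f≥0 ∘ suc))

  +-nonneg-≡0 : ∀ {i j} → 0ℤ ≤ i → 0ℤ ≤ j → i + j ≡ 0ℤ → i ≡ 0ℤ × j ≡ 0ℤ
  +-nonneg-≡0 {+0}       {+0}       _ _ _  = refl , refl
  +-nonneg-≡0 {+0}       {+[1+ _ ]} _ _ ()
  +-nonneg-≡0 {+[1+ _ ]} {+ _}      _ _ ()

  ∑-nonneg-≡0 : ∀ {n} (f : Fin n → ℤ) → (∀ i → 0ℤ ≤ f i) → ∑[ i < n ] f i ≡ 0ℤ → ∀ i → f i ≡ 0ℤ
  ∑-nonneg-≡0 {suc n} f f≥0 ∑f≡0 i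
    with +-nonneg-≡0 (f≥0 zero) (∑-nonneg (f ∘ suc) (f≥0 ∘ suc)) ∑f≡0
  ∑-nonneg-≡0 {suc n} f f≥0 ∑f≡0 zero    | f₀≡0 , _    = f₀≡0
  ∑-nonneg-≡0 {suc n} f f≥0 ∑f≡0 (suc i) | _    , rest = ∑-nonneg-≡0 (f ∘ suc) (f≥0 ∘ suc) rest i

  *-nonneg : ∀ {i j} → 0ℤ ≤ i → 0ℤ ≤ j → 0ℤ ≤ i * j
  *-nonneg {+ m} {+ n} _ _ = subst (0ℤ ≤_) (pos-* m n) (+≤+ ℕ.z≤n)

  0≤i*i : ∀ i → 0ℤ ≤ i * i
  0≤i*i (+ m)     = *-nonneg {+ m} {+ m} (+≤+ ℕ.z≤n) (+≤+ ℕ.z≤n)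
  0≤i*i -[1+ m ] = +≤+ ℕ.z≤n

  0≤i*[i+1] : ∀ i → 0ℤ ≤ i * (i + 1ℤ)
  0≤i*[i+1] (+ m)        = *-nonneg {+ m} {+ m + 1ℤ} (+≤+ ℕ.z≤n) (subst (0ℤ ≤_) (pos-+ m 1) (+≤+ ℕ.z≤n))
  0≤i*[i+1] -[1+ zero ]  = +≤+ ℕ.z≤n
  0≤i*[i+1] -[1+ suc m ] = +≤+ ℕ.z≤n

  i≡-i⇒i≡0 : ∀ {i} → i ≡ - i → i ≡ 0ℤ
  i≡-i⇒i≡0 {+0}       _  = refl
  i≡-i⇒i≡0 {+[1+ _ ]} ()
  i≡-i⇒i≡0 { -[1+ _ ]} ()

  +-solveʳ : ∀ {x y c} → x + y ≡ c → y ≡ c - x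
  +-solveʳ {x} {y} refl = ring x y
    where
    ring : ∀ x y → y ≡ x + y - x
    ring = solve-∀

  +-solveˡ : ∀ {x y c} → x + y ≡ c → x ≡ c - y
  +-solveˡ {x} {y} refl = ring x y
    where
    ring : ∀ x y → x ≡ x + y - y
    ring = solve-∀

  *-distribʳ-sub : ∀ x y z → (y - z) * x ≡ y * x - z * x
  *-distribʳ-sub = solve-∀

  i*[i+1]≡0⇒0≤-2i : ∀ {i} → i * (i + 1ℤ) ≡ 0ℤ → 0ℤ ≤ - (+ 2 * i)
  i*[i+1]≡0⇒0≤-2i {+0}       _  = +≤+ ℕ.z≤n
  i*[i+1]≡0⇒0≤-2i {+[1+ _ ]} ()
  i*[i+1]≡0⇒0≤-2i { -[1+ _ ]} _  = +≤+ ℕ.z≤n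

  k*i≡0⇒i≡0 : ∀ {k i} → 0ℤ < k → k * i ≡ 0ℤ → i ≡ 0ℤ
  k*i≡0⇒i≡0 {+[1+ _ ]} {+0}       _ _  = refl
  k*i≡0⇒i≡0 {+[1+ _ ]} {+[1+ _ ]} _ ()
  k*i≡0⇒i≡0 {+[1+ _ ]} { -[1+ _ ]} _ ()
  k*i≡0⇒i≡0 {+0}       (+<+ ())

  0≤k*x⇒0≤x : ∀ {k x} → 0ℤ < k → 0ℤ ≤ k * x → 0ℤ ≤ x
  0≤k*x⇒0≤x {+[1+ k ]} {+ x}      _ _  = +≤+ ℕ.z≤n
  0≤k*x⇒0≤x {+[1+ k ]} { -[1+ x ]} _ ()
  0≤k*x⇒0≤x {+0}       (+<+ ())

  i-j≡i⇒j≡0 : ∀ {i j} → i - j ≡ i → j ≡ 0ℤ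
  i-j≡i⇒j≡0 {i} {j} i-j≡i = trans (ring i j) (trans (cong (_-_ i) i-j≡i) (+-inverseʳ i))
    where
    ring : ∀ i j → j ≡ i - (i - j)
    ring = solve-∀

module Vectors where

  open import Data.Nat.Base as ℕ using (ℕ; zero; suc)
  open import Data.Fin.Base using (Fin)
  open import Data.Integer.Base hiding (suc; _^_)
  import Data.Integer.Base as ℤ
  open import Data.Integer.Properties
  open import Data.Integer.Tactic.RingSolver using (solve; solve-∀)
  open import Data.List.Base using (List; _∷_; []; _++_; replicate)
  open import Data.Vec.Functional using (Vector)
  open import Data.Sum.Base using (inj₁; inj₂)
  open import Relation.Binary.PropositionalEquality
  open FiniteSums

  Matrix : ℕ → Set
  Matrix n = Fin n → Fin n → ℤ

  module _ {n : ℕ} where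

    ⟨_,_⟩ : Vector ℤ n → Vector ℤ n → ℤ
    ⟨ f , g ⟩ = ∑[ i < n ] (f i * g i)

    infixr 7 _⊛_
    _⊛_ : Matrix n → Vector ℤ n → Vector ℤ n
    (M ⊛ f) i = ∑[ j < n ] (M i j * f j)

    infixr 7 _^_⊛_
    _^_⊛_ : Matrix n → ℕ → Vector ℤ n → Vector ℤ n
    M ^ zero  ⊛ f = f
    M ^ suc k ⊛ f = M ⊛ (M ^ k ⊛ f)

    ⟨⟩-comm : ∀ f g → ⟨ f , g ⟩ ≡ ⟨ g , f ⟩
    ⟨⟩-comm f g = sum-cong-≗ (λ i → *-comm (f i) (g i))

    ⟨⟩-congʳ : ∀ f {g h} → g ≗ h → ⟨ f , g ⟩ ≡ ⟨ f , h ⟩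
    ⟨⟩-congʳ f g≗h = sum-cong-≗ (λ i → cong (f i *_) (g≗h i))

    ⊛-cong : ∀ M {f g} → f ≗ g → M ⊛ f ≗ M ⊛ g
    ⊛-cong M f≗g i = ⟨⟩-congʳ (M i) f≗g

    ⟨⟩-linearʳ : ∀ g c f h → ⟨ g , (λ i → c * f i + h i) ⟩ ≡ c * ⟨ g , f ⟩ + ⟨ g , h ⟩
    ⟨⟩-linearʳ g c f h = begin
      ∑[ i < n ] (g i * (c * f i + h i))        ≡⟨ sum-cong-≗ (λ i → ring (g i) c (f i) (h i)) ⟩
      ∑[ i < n ] (c * (g i * f i) + g i * h i)  ≡⟨ ∑-distrib-+ (λ i → c * (g i * f i)) (λ i → g i * h i) ⟩
      ∑[ i < n ] (c * (g i * f i)) + ⟨ g , h ⟩  ≡⟨ cong (_+ ⟨ g , h ⟩) (∑-*ˡ c (λ i → g i * f i)) ⟩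
      c * ⟨ g , f ⟩ + ⟨ g , h ⟩                 ∎
      where
      open ≡-Reasoning
      ring : ∀ x c y z → x * (c * y + z) ≡ c * (x * y) + x * z
      ring = solve-∀

    ⟨⟩-zeroʳ : ∀ g → ⟨ g , (λ _ → 0ℤ) ⟩ ≡ 0ℤ
    ⟨⟩-zeroʳ g = trans (sum-cong-≗ (λ i → *-zeroʳ (g i))) (∑-zero n)

    ⊛-δ : ∀ M a → M ⊛ δ a ≗ (λ b → M b a)
    ⊛-δ M a b = trans (sum-cong-≗ λ x → *-comm (M b x) (δ a x)) (∑-δ a (M b))

    ⊛-linear : ∀ M c f h → M ⊛ (λ j → c * f j + h j) ≗ (λ i → c * (M ⊛ f) i + (M ⊛ h) i)
    ⊛-linear M c f h i = ⟨⟩-linearʳ (M i) c f h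

    ⊛-zero : ∀ M → M ⊛ (λ _ → 0ℤ) ≗ (λ _ → 0ℤ)
    ⊛-zero M i = ⟨⟩-zeroʳ (M i)

    ^-suc : ∀ M k f → M ^ k ⊛ (M ⊛ f) ≗ M ^ suc k ⊛ f
    ^-suc M zero    f i = refl
    ^-suc M (suc k) f = ⊛-cong M (^-suc M k f)

    ^-cong : ∀ M k {f g} → f ≗ g → M ^ k ⊛ f ≗ M ^ k ⊛ g
    ^-cong M zero    f≗g = f≗g
    ^-cong M (suc k) f≗g = ⊛-cong M (^-cong M k f≗g)

    ^-+ : ∀ M k j f → M ^ (k ℕ.+ j) ⊛ f ≗ M ^ k ⊛ (M ^ j ⊛ f)
    ^-+ M zero    j f i = refl
    ^-+ M (suc k) j f = ⊛-cong M (^-+ M k j f)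

    ⟨f,f⟩≥0 : ∀ (f : Vector ℤ n) → 0ℤ ≤ ⟨ f , f ⟩
    ⟨f,f⟩≥0 f = ∑-nonneg (λ i → f i * f i) (λ i → 0≤i*i (f i))

    ⟨f,f⟩≡0⇒f≗0 : ∀ (f : Vector ℤ n) → ⟨ f , f ⟩ ≡ 0ℤ → ∀ i → f i ≡ 0ℤ
    ⟨f,f⟩≡0⇒f≗0 f ⟨f,f⟩≡0 i
      with i*j≡0⇒i≡0∨j≡0 (f i) (∑-nonneg-≡0 (λ i → f i * f i) (λ i → 0≤i*i (f i)) ⟨f,f⟩≡0 i)
    ... | inj₁ fᵢ≡0 = fᵢ≡0
    ... | inj₂ fᵢ≡0 = fᵢ≡0

    ⟨⟩-combination : ∀ a b c (x y z : Vector ℤ n) →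
      ⟨ (λ i → a * x i + b * y i + c * z i) , (λ i → a * x i + b * y i + c * z i) ⟩
      ≡ a * a * ⟨ x , x ⟩ + b * b * ⟨ y , y ⟩ + c * c * ⟨ z , z ⟩
        + + 2 * a * b * ⟨ x , y ⟩ + + 2 * a * c * ⟨ x , z ⟩ + + 2 * b * c * ⟨ y , z ⟩
    ⟨⟩-combination a b c x y z =
      trans (sum-cong-≗ λ i → expand a b c (x i) (y i) (z i))
      (trans (∑-distrib-+⁶ (λ i → a * a * (x i * x i)) (λ i → b * b * (y i * y i)) (λ i → c * c * (z i * z i))
                          (λ i → + 2 * a * b * (x i * y i)) (λ i → + 2 * a * c * (x i * z i)) (λ i → + 2 * b * c * (y i * z i)))
        (cong₂ _+_ (cong₂ _+_ (cong₂ _+_ (cong₂ _+_ (cong₂ _+_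
          (∑-*ˡ (a * a) (λ i → x i * x i)) (∑-*ˡ (b * b) (λ i → y i * y i))) (∑-*ˡ (c * c) (λ i → z i * z i)))
          (∑-*ˡ (+ 2 * a * b) (λ i → x i * y i))) (∑-*ˡ (+ 2 * a * c) (λ i → x i * z i))) (∑-*ˡ (+ 2 * b * c) (λ i → y i * z i))))
      where
      expand : ∀ a b c x y z → (a * x + b * y + c * z) * (a * x + b * y + c * z)
               ≡ a * a * (x * x) + b * b * (y * y) + c * c * (z * z)
                 + + 2 * a * b * (x * y) + + 2 * a * c * (x * z) + + 2 * b * c * (y * z)
      expand = solve-∀

    bessel : ∀ (r x y : Vector ℤ n) → ⟨ x , y ⟩ ≡ 0ℤ →
      0ℤ ≤ ⟨ x , x ⟩ * ⟨ y , y ⟩ * (⟨ x , x ⟩ * ⟨ y , y ⟩ * ⟨ r , r ⟩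
                                    - ⟨ y , y ⟩ * (⟨ r , x ⟩ * ⟨ r , x ⟩) - ⟨ x , x ⟩ * (⟨ r , y ⟩ * ⟨ r , y ⟩))
    bessel r x y ⟨x,y⟩≡0 =
      subst (0ℤ ≤_) (trans (⟨⟩-combination a b c r x y) (ring ⟨ x , x ⟩ ⟨ y , y ⟩ ⟨ r , r ⟩ ⟨ r , x ⟩ ⟨ r , y ⟩ ⟨x,y⟩≡0))
        (⟨f,f⟩≥0 (λ i → a * r i + b * x i + c * y i))
      where
      a = ⟨ x , x ⟩ * ⟨ y , y ⟩
      b = - (⟨ y , y ⟩ * ⟨ r , x ⟩)
      c = - (⟨ x , x ⟩ * ⟨ r , y ⟩)
      ring : ∀ X Y Q p q {o} → o ≡ 0ℤ →
        X * Y * (X * Y) * Q + - (Y * p) * - (Y * p) * X + - (X * q) * - (X * q) * Y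
          + + 2 * (X * Y) * - (Y * p) * p + + 2 * (X * Y) * - (X * q) * q + + 2 * - (Y * p) * - (X * q) * o
        ≡ X * Y * (X * Y * Q - Y * (p * p) - X * (q * q))
      ring X Y Q p q refl = solve (X ∷ Y ∷ Q ∷ p ∷ q ∷ [])

    cauchy-schwarz : ∀ (r x : Vector ℤ n) → 0ℤ ≤ ⟨ x , x ⟩ * (⟨ x , x ⟩ * ⟨ r , r ⟩ - ⟨ r , x ⟩ * ⟨ r , x ⟩)
    cauchy-schwarz r x =
      subst (0ℤ ≤_) (trans (⟨⟩-combination ⟨ x , x ⟩ (- ⟨ r , x ⟩) 0ℤ r x x) (ring ⟨ x , x ⟩ ⟨ r , r ⟩ ⟨ r , x ⟩))
        (⟨f,f⟩≥0 (λ i → ⟨ x , x ⟩ * r i + - ⟨ r , x ⟩ * x i + 0ℤ * x i))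
      where
      ring : ∀ X Q p →
        X * X * Q + - p * - p * X + 0ℤ * 0ℤ * X + + 2 * X * - p * p + + 2 * X * 0ℤ * p + + 2 * - p * 0ℤ * X
        ≡ X * (X * Q - p * p)
      ring = solve-∀

  module Skew {n : ℕ} (S : Matrix n) (skew : ∀ i j → S j i ≡ - S i j) where

    ⟨⟩-skew : ∀ f g → ⟨ f , S ⊛ g ⟩ ≡ - ⟨ S ⊛ f , g ⟩
    ⟨⟩-skew f g = begin
      ∑[ i < n ] (f i * ∑[ j < n ] (S i j * g j))          ≡⟨ sum-cong-≗ (λ i → ∑-*ˡ (f i) (λ j → S i j * g j)) ⟨
      ∑[ i < n ] ∑[ j < n ] (f i * (S i j * g j))          ≡⟨ ∑-comm (λ i j → f i * (S i j * g j)) ⟩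
      ∑[ j < n ] ∑[ i < n ] (f i * (S i j * g j))          ≡⟨ sum-cong-≗ (λ j → sum-cong-≗ (λ i → flip-entry (f i) (g j) (skew j i))) ⟩
      ∑[ j < n ] ∑[ i < n ] (- (S j i * f i) * g j)        ≡⟨ sum-cong-≗ (λ j → ∑-*ʳ (g j) (λ i → - (S j i * f i))) ⟩
      ∑[ j < n ] (∑[ i < n ] (- (S j i * f i)) * g j)      ≡⟨ sum-cong-≗ (λ j → cong (_* g j) (∑-neg (λ i → S j i * f i))) ⟩
      ∑[ j < n ] (- (S ⊛ f) j * g j)                       ≡⟨ sum-cong-≗ (λ j → neg-distribˡ-* ((S ⊛ f) j) (g j)) ⟨
      ∑[ j < n ] (- ((S ⊛ f) j * g j))                     ≡⟨ ∑-neg (λ j → (S ⊛ f) j * g j) ⟩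
      - ⟨ S ⊛ f , g ⟩                                      ∎
      where
      open ≡-Reasoning
      flip-entry : ∀ x y {a b} → a ≡ - b → x * (a * y) ≡ - (b * x) * y
      flip-entry x y {b = b} refl = solve (x ∷ y ∷ b ∷ [])

    ⟨f,Sf⟩≡0 : ∀ f → ⟨ f , S ⊛ f ⟩ ≡ 0ℤ
    ⟨f,Sf⟩≡0 f = i≡-i⇒i≡0 (trans (⟨⟩-skew f f) (cong -_ (⟨⟩-comm (S ⊛ f) f)))

    ⟨⟩-skew-pow : ∀ k f g → ⟨ f , S ^ k ⊛ g ⟩ ≡ -1ℤ ℤ.^ k * ⟨ S ^ k ⊛ f , g ⟩
    ⟨⟩-skew-pow zero    f g = sym (*-identityˡ ⟨ f , g ⟩)
    ⟨⟩-skew-pow (suc k) f g = begin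
      ⟨ f , S ⊛ (S ^ k ⊛ g) ⟩                     ≡⟨ ⟨⟩-skew f (S ^ k ⊛ g) ⟩
      - ⟨ S ⊛ f , S ^ k ⊛ g ⟩                     ≡⟨ cong -_ (⟨⟩-skew-pow k (S ⊛ f) g) ⟩
      - (-1ℤ ℤ.^ k * ⟨ S ^ k ⊛ (S ⊛ f) , g ⟩)     ≡⟨ cong (λ x → - (-1ℤ ℤ.^ k * x)) (sum-cong-≗ (λ i → cong (_* g i) (^-suc S k f i))) ⟩
      - (-1ℤ ℤ.^ k * ⟨ S ^ suc k ⊛ f , g ⟩)       ≡⟨ neg-distribˡ-* (-1ℤ ℤ.^ k) _ ⟩
      - -1ℤ ℤ.^ k * ⟨ S ^ suc k ⊛ f , g ⟩         ≡⟨ cong (_* ⟨ S ^ suc k ⊛ f , g ⟩) (-1*i≡-i (-1ℤ ℤ.^ k)) ⟨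
      -1ℤ * -1ℤ ℤ.^ k * ⟨ S ^ suc k ⊛ f , g ⟩     ∎
      where open ≡-Reasoning

    ⟨f,S²ᵏf⟩ : ∀ k f → ⟨ f , S ^ (k ℕ.+ k) ⊛ f ⟩ ≡ -1ℤ ℤ.^ k * ⟨ S ^ k ⊛ f , S ^ k ⊛ f ⟩
    ⟨f,S²ᵏf⟩ k f = trans (⟨⟩-congʳ f (^-+ S k k f)) (⟨⟩-skew-pow k f (S ^ k ⊛ f))

    ⟨f,S²ᵏ⁺¹f⟩≡0 : ∀ k f → ⟨ f , S ^ suc (k ℕ.+ k) ⊛ f ⟩ ≡ 0ℤ
    ⟨f,S²ᵏ⁺¹f⟩≡0 k f = begin
      ⟨ f , S ^ suc (k ℕ.+ k) ⊛ f ⟩                      ≡⟨ ⟨⟩-congʳ f (^-+ S (suc k) k f) ⟩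
      ⟨ f , S ^ suc k ⊛ (S ^ k ⊛ f) ⟩                    ≡⟨ ⟨⟩-skew-pow (suc k) f (S ^ k ⊛ f) ⟩
      -1ℤ ℤ.^ suc k * ⟨ S ⊛ (S ^ k ⊛ f) , S ^ k ⊛ f ⟩    ≡⟨ cong (-1ℤ ℤ.^ suc k *_) (⟨⟩-comm (S ⊛ (S ^ k ⊛ f)) (S ^ k ⊛ f)) ⟩
      -1ℤ ℤ.^ suc k * ⟨ S ^ k ⊛ f , S ⊛ (S ^ k ⊛ f) ⟩    ≡⟨ cong (-1ℤ ℤ.^ suc k *_) (⟨f,Sf⟩≡0 (S ^ k ⊛ f)) ⟩
      -1ℤ ℤ.^ suc k * 0ℤ                                 ≡⟨ *-zeroʳ (-1ℤ ℤ.^ suc k) ⟩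
      0ℤ                                                 ∎
      where open ≡-Reasoning

  module Polynomial {n : ℕ} (M : Matrix n) where

    applyPoly : List ℤ → Vector ℤ n → Vector ℤ n
    applyPoly []       f i = 0ℤ
    applyPoly (c ∷ cs) f i = c * f i + applyPoly cs (M ⊛ f) i

    moments : List ℤ → Vector ℤ n → Vector ℤ n → ℤ
    moments []       g f = 0ℤ
    moments (c ∷ cs) g f = c * ⟨ g , f ⟩ + moments cs g (M ⊛ f)

    ⟨⟩-applyPoly : ∀ cs g f → ⟨ g , applyPoly cs f ⟩ ≡ moments cs g f
    ⟨⟩-applyPoly []       g f = ⟨⟩-zeroʳ g
    ⟨⟩-applyPoly (c ∷ cs) g f =
      trans (⟨⟩-linearʳ g c f (applyPoly cs (M ⊛ f))) (cong (_+_ (c * ⟨ g , f ⟩)) (⟨⟩-applyPoly cs g (M ⊛ f)))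

    ⊛-applyPoly : ∀ cs f → M ⊛ applyPoly cs f ≗ applyPoly cs (M ⊛ f)
    ⊛-applyPoly []       f = ⊛-zero M
    ⊛-applyPoly (c ∷ cs) f i =
      trans (⊛-linear M c f (applyPoly cs (M ⊛ f)) i) (cong (_+_ (c * (M ⊛ f) i)) (⊛-applyPoly cs (M ⊛ f) i))

    -- The coefficients of p + (X - 1) * (c₀ + c₁ X + …).
    shiftSub : ℤ → List ℤ → List ℤ
    shiftSub p []       = p ∷ []
    shiftSub p (c ∷ cs) = (p - c) ∷ shiftSub c cs

    applyPoly-shiftSub : ∀ p cs f i →
      applyPoly (shiftSub p cs) f i ≡ p * f i + applyPoly cs (M ⊛ f) i - applyPoly cs f i
    applyPoly-shiftSub p []       f i = ring p (f i)
      where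
      ring : ∀ p x → p * x + 0ℤ ≡ p * x + 0ℤ - 0ℤ
      ring = solve-∀
    applyPoly-shiftSub p (c ∷ cs) f i = begin
      (p - c) * f i + applyPoly (shiftSub c cs) (M ⊛ f) i
        ≡⟨ cong (_+_ ((p - c) * f i)) (applyPoly-shiftSub c cs (M ⊛ f) i) ⟩
      (p - c) * f i + (c * (M ⊛ f) i + applyPoly cs (M ⊛ (M ⊛ f)) i - applyPoly cs (M ⊛ f) i)
        ≡⟨ ring p c (f i) ((M ⊛ f) i) (applyPoly cs (M ⊛ (M ⊛ f)) i) (applyPoly cs (M ⊛ f) i) ⟩
      p * f i + (c * (M ⊛ f) i + applyPoly cs (M ⊛ (M ⊛ f)) i) - (c * f i + applyPoly cs (M ⊛ f) i)
        ∎
      where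
      open ≡-Reasoning
      ring : ∀ p c x y a b → (p - c) * x + (c * y + a - b) ≡ p * x + (c * y + a) - (c * x + b)
      ring = solve-∀

    M-I : Matrix n
    M-I i j = M i j - δ i j

    M-I⊛ : ∀ f → M-I ⊛ f ≗ (λ i → (M ⊛ f) i - f i)
    M-I⊛ f i = begin
      ∑[ j < n ] ((M i j - δ i j) * f j)                     ≡⟨ sum-cong-≗ (λ j → *-distribʳ-sub (f j) (M i j) (δ i j)) ⟩
      ∑[ j < n ] (M i j * f j - δ i j * f j)                 ≡⟨ ∑-distrib-sub (λ j → M i j * f j) (λ j → δ i j * f j) ⟩
      (M ⊛ f) i - ∑[ j < n ] (δ i j * f j)                   ≡⟨ cong (_-_ ((M ⊛ f) i)) (∑-δ i f) ⟩
      (M ⊛ f) i - f i                                        ∎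
      where open ≡-Reasoning

    -- The coefficients of (X - 1)ᵏ, constant term first.
    binomialCoeffs : ℕ → List ℤ
    binomialCoeffs zero    = 1ℤ ∷ []
    binomialCoeffs (suc k) = shiftSub 0ℤ (binomialCoeffs k)

    M-I-pow : ∀ k f → M-I ^ k ⊛ f ≗ applyPoly (binomialCoeffs k) f
    M-I-pow zero    f i = sym (trans (+-identityʳ (1ℤ * f i)) (*-identityˡ (f i)))
    M-I-pow (suc k) f i = begin
      (M-I ⊛ (M-I ^ k ⊛ f)) i                               ≡⟨ ⊛-cong M-I (M-I-pow k f) i ⟩
      (M-I ⊛ applyPoly cs f) i                              ≡⟨ M-I⊛ (applyPoly cs f) i ⟩
      (M ⊛ applyPoly cs f) i - applyPoly cs f i             ≡⟨ cong (_- applyPoly cs f i) (⊛-applyPoly cs f i) ⟩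
      applyPoly cs (M ⊛ f) i - applyPoly cs f i             ≡⟨ cong (_- applyPoly cs f i) (trans (cong (_+ y) (*-zeroˡ (f i))) (+-identityˡ y)) ⟨
      0ℤ * f i + applyPoly cs (M ⊛ f) i - applyPoly cs f i  ≡⟨ applyPoly-shiftSub 0ℤ cs f i ⟨
      applyPoly (shiftSub 0ℤ cs) f i                        ∎
      where
      open ≡-Reasoning
      cs = binomialCoeffs k
      y = applyPoly cs (M ⊛ f) i

    moments-pad : ∀ cs k g f → moments (cs ++ replicate k 0ℤ) g f ≡ moments cs g f
    moments-pad []       zero    g f = refl
    moments-pad []       (suc k) g f =
      trans (cong (_+_ (0ℤ * ⟨ g , f ⟩)) (moments-pad [] k g (M ⊛ f))) (trans (+-identityʳ _) (*-zeroˡ ⟨ g , f ⟩))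
    moments-pad (c ∷ cs) k       g f = cong (_+_ (c * ⟨ g , f ⟩)) (moments-pad cs k g (M ⊛ f))

  module SkewMoments {n : ℕ} (S : Matrix n) (skew : ∀ i j → S j i ≡ - S i j) where
    open Skew S skew
    open Polynomial S

    moments-skew : ∀ c₀ c₁ c₂ c₃ c₄ c₅ f →
      moments (c₀ ∷ c₁ ∷ c₂ ∷ c₃ ∷ c₄ ∷ c₅ ∷ []) f f
      ≡ c₀ * ⟨ f , f ⟩ - c₂ * ⟨ S ⊛ f , S ⊛ f ⟩ + c₄ * ⟨ S ^ 2 ⊛ f , S ^ 2 ⊛ f ⟩
    moments-skew c₀ c₁ c₂ c₃ c₄ c₅ f =
      evaluate (⟨f,Sf⟩≡0 f) (⟨f,S²ᵏf⟩ 1 f) (⟨f,S²ᵏ⁺¹f⟩≡0 1 f) (⟨f,S²ᵏf⟩ 2 f) (⟨f,S²ᵏ⁺¹f⟩≡0 2 f)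
      where
      ν : ℕ → ℤ
      ν j = ⟨ S ^ j ⊛ f , S ^ j ⊛ f ⟩
      evaluate : ∀ {μ₁ μ₂ μ₃ μ₄ μ₅} →
        μ₁ ≡ 0ℤ → μ₂ ≡ -1ℤ * 1ℤ * ν 1 → μ₃ ≡ 0ℤ → μ₄ ≡ -1ℤ * (-1ℤ * 1ℤ) * ν 2 → μ₅ ≡ 0ℤ →
        c₀ * ⟨ f , f ⟩ + (c₁ * μ₁ + (c₂ * μ₂ + (c₃ * μ₃ + (c₄ * μ₄ + (c₅ * μ₅ + 0ℤ)))))
        ≡ c₀ * ⟨ f , f ⟩ - c₂ * ν 1 + c₄ * ν 2
      evaluate refl refl refl refl refl = ring c₀ c₁ c₂ c₃ c₄ c₅ ⟨ f , f ⟩ (ν 1) (ν 2)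
        where
        ring : ∀ c₀ c₁ c₂ c₃ c₄ c₅ x y z →
          c₀ * x + (c₁ * 0ℤ + (c₂ * (-1ℤ * 1ℤ * y) + (c₃ * 0ℤ + (c₄ * (-1ℤ * (-1ℤ * 1ℤ) * z) + (c₅ * 0ℤ + 0ℤ)))))
          ≡ c₀ * x - c₂ * y + c₄ * z
        ring = solve-∀

module FiveCycles where

  open import Data.Nat.Base as ℕ using (ℕ; zero; suc)
  open import Data.Fin.Base using (Fin; zero; suc; _<_; _≤_)
  open import Data.Fin.Properties using (≤∧≢⇒<; <-asym; ≤-totalOrder) renaming (_<?_ to _<ᶠ?_; _≟_ to _≟ᶠ_)
  open import Data.Integer.Base hiding (suc; _<_; _≤_)
  open import Data.Integer.Properties using (pos-+; *-identityˡ; *-identityʳ; *-zeroʳ)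
  open import Data.Integer.Tactic.RingSolver using (solve-∀)
  open import Data.Bool.Base using (Bool; true; false; _∧_; if_then_else_; not)
  open import Data.Bool.Properties using (∧-zeroʳ; ∧-identityʳ; ∧-assoc)
  open import Data.List.Base using ([]; _∷_; map; tabulate)
  open import Data.List.Relation.Unary.All using (All; []; _∷_)
  open import Data.List.Membership.Propositional using (_∈_)
  open import Data.List.Relation.Unary.Any using (here; there)
  open import Data.Nat.ListAction using () renaming (sum to sumℕ)
  open import Data.Product.Base using (_×_; _,_)
  open import Data.Sum.Base using (_⊎_; inj₁; inj₂)
  open import Function.Base using (_∘_; id)
  open import Relation.Binary.PropositionalEquality
  open import Relation.Nullary using (¬_)
  open import Relation.Nullary.Decidable using (dec-true; dec-false)
  open import Defs
  open FiniteSums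

  χ : Bool → ℤ
  χ true  = 1ℤ
  χ false = 0ℤ

  χ-∧ : ∀ x y → χ (x ∧ y) ≡ χ x * χ y
  χ-∧ true  y = sym (*-identityˡ (χ y))
  χ-∧ false y = refl

  χ-not : ∀ x → χ (not x) + χ x ≡ 1ℤ
  χ-not true  = refl
  χ-not false = refl

  χ-not-* : ∀ x → χ (not x) * χ x ≡ 0ℤ
  χ-not-* true  = refl
  χ-not-* false = refl

  χ-idem : ∀ x → χ x * χ x ≡ χ x
  χ-idem true  = refl
  χ-idem false = refl

  sum-tabulate : ∀ {m k} (g : Fin k → Fin m) (f : Fin m → ℕ) →
    + sumℕ (map f (tabulate g)) ≡ ∑[ i < k ] (+ f (g i))
  sum-tabulate {k = zero}  g f = refl
  sum-tabulate {k = suc k} g f =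
    trans (pos-+ (f (g zero)) _) (cong (_+_ (+ f (g zero))) (sum-tabulate (g ∘ suc) f))

  sumFin≡∑ : ∀ {n} (f : Fin n → ℕ) → + sumFin f ≡ ∑[ i < n ] (+ f i)
  sumFin≡∑ = sum-tabulate id

  sumFin-cong : ∀ {n} {f : Fin n → ℕ} {g : Fin n → ℤ} → (∀ i → + f i ≡ g i) → + sumFin f ≡ ∑[ i < n ] g i
  sumFin-cong {f = f} f≡g = trans (sumFin≡∑ f) (sum-cong-≗ f≡g)

  countFin≡∑ : ∀ {n} (p : Fin n → Bool) → + countFin p ≡ ∑[ i < n ] χ (p i)
  countFin≡∑ p = trans (sumFin≡∑ (λ i → if p i then 1 else 0)) (sum-cong-≗ (λ i → χ-if (p i)))
    where
    χ-if : ∀ b → + (if b then 1 else 0) ≡ χ b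
    χ-if true  = refl
    χ-if false = refl

  module _ {n : ℕ} where

    Σ⁵ : (Fin n → Fin n → Fin n → Fin n → Fin n → ℤ) → ℤ
    Σ⁵ F = ∑[ a < n ] ∑[ b < n ] ∑[ c < n ] ∑[ d < n ] ∑[ e < n ] F a b c d e

    Σ⁵-cong : ∀ {F G} → (∀ a b c d e → F a b c d e ≡ G a b c d e) → Σ⁵ F ≡ Σ⁵ G
    Σ⁵-cong F≡G = sum-cong-≗ λ a → sum-cong-≗ λ b → sum-cong-≗ λ c → sum-cong-≗ λ d → sum-cong-≗ λ e → F≡G a b c d e

    Σ⁵-distrib-+ : ∀ F G → Σ⁵ (λ a b c d e → F a b c d e + G a b c d e) ≡ Σ⁵ F + Σ⁵ G
    Σ⁵-distrib-+ F G =
      ∑-split λ a → ∑-split λ b → ∑-split λ c → ∑-split λ d → ∑-distrib-+ (F a b c d) (G a b c d)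

    Σ⁵-*ˡ : ∀ x F → Σ⁵ (λ a b c d e → x * F a b c d e) ≡ x * Σ⁵ F
    Σ⁵-*ˡ x F =
      trans (sum-cong-≗ λ a → ∑⁴-*ˡ x (F a)) (∑-*ˡ x (λ a → ∑[ b < n ] ∑[ c < n ] ∑[ d < n ] ∑[ e < n ] F a b c d e))

    Σ⁵-rotate : ∀ F → Σ⁵ (λ a b c d e → F b c d e a) ≡ Σ⁵ F
    Σ⁵-rotate F =
      trans (∑-comm (λ a b → ∑[ c < n ] ∑[ d < n ] ∑[ e < n ] F b c d e a))
      (sum-cong-≗ λ b → trans (∑-comm (λ a c → ∑[ d < n ] ∑[ e < n ] F b c d e a))
      (sum-cong-≗ λ c → trans (∑-comm (λ a d → ∑[ e < n ] F b c d e a))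
      (sum-cong-≗ λ d → ∑-comm (λ a e → F b c d e a))))

    rotations : (Fin n → Fin n → Fin n → Fin n → Fin n → ℤ) → Fin n → Fin n → Fin n → Fin n → Fin n → ℤ
    rotations F a b c d e = F a b c d e + F b c d e a + F c d e a b + F d e a b c + F e a b c d

    rotations-rotate : ∀ F a b c d e → rotations F b c d e a ≡ rotations F a b c d e
    rotations-rotate F a b c d e = ring (F a b c d e) (F b c d e a) (F c d e a b) (F d e a b c) (F e a b c d)
      where
      ring : ∀ x₁ x₂ x₃ x₄ x₅ → x₂ + x₃ + x₄ + x₅ + x₁ ≡ x₁ + x₂ + x₃ + x₄ + x₅
      ring = solve-∀

    Σ⁵-rotations : ∀ F → Σ⁵ (rotations F) ≡ + 5 * Σ⁵ F
    Σ⁵-rotations F = begin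
      Σ⁵ (rotations F)                            ≡⟨ split ⟩
      Σ⁵ F + Σ⁵ F₁ + Σ⁵ F₂ + Σ⁵ F₃ + Σ⁵ F₄        ≡⟨ cong₂ _+_ (cong₂ _+_ (cong₂ _+_ (cong (_+_ (Σ⁵ F)) F₁≡F) F₂≡F) F₃≡F) F₄≡F ⟩
      Σ⁵ F + Σ⁵ F + Σ⁵ F + Σ⁵ F + Σ⁵ F            ≡⟨ ring (Σ⁵ F) ⟩
      + 5 * Σ⁵ F                                  ∎
      where
      open ≡-Reasoning
      F₁ F₂ F₃ F₄ : Fin n → Fin n → Fin n → Fin n → Fin n → ℤ
      F₁ a b c d e = F b c d e a
      F₂ a b c d e = F₁ b c d e a
      F₃ a b c d e = F₂ b c d e a
      F₄ a b c d e = F₃ b c d e a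
      F₁≡F = Σ⁵-rotate F
      F₂≡F = trans (Σ⁵-rotate F₁) F₁≡F
      F₃≡F = trans (Σ⁵-rotate F₂) F₂≡F
      F₄≡F = trans (Σ⁵-rotate F₃) F₃≡F
      split = trans (Σ⁵-distrib-+ _ F₄) (cong (_+ Σ⁵ F₄) (trans (Σ⁵-distrib-+ _ F₃) (cong (_+ Σ⁵ F₃)
                (trans (Σ⁵-distrib-+ _ F₂) (cong (_+ Σ⁵ F₂) (Σ⁵-distrib-+ F F₁))))))
      ring : ∀ x → x + x + x + x + x ≡ + 5 * x
      ring = solve-∀

    lt-true : ∀ {i j : Fin n} → i < j → lt i j ≡ true
    lt-true {i} {j} = dec-true (i <ᶠ? j)

    lt-false : ∀ {i j : Fin n} → j < i → lt i j ≡ false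
    lt-false {i} {j} j<i = dec-false (i <ᶠ? j) (<-asym j<i)

    neq-true : ∀ {i j : Fin n} → ¬ i ≡ j → neq i j ≡ true
    neq-true {i} {j} i≢j = cong not (dec-false (i ≟ᶠ j) i≢j)

    record Distinct5 (a b c d e : Fin n) : Set where
      field
        a≢b : ¬ a ≡ b
        b≢c : ¬ b ≡ c
        c≢d : ¬ c ≡ d
        d≢e : ¬ d ≡ e
        e≢a : ¬ e ≡ a
        a≢c : ¬ a ≡ c
        b≢d : ¬ b ≡ d
        c≢e : ¬ c ≡ e
        d≢a : ¬ d ≡ a
        e≢b : ¬ e ≡ b

    rotate : ∀ {a b c d e} → Distinct5 a b c d e → Distinct5 b c d e a
    rotate D = record
      { a≢b = b≢c ; b≢c = c≢d ; c≢d = d≢e ; d≢e = e≢a ; e≢a = a≢b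
      ; a≢c = b≢d ; b≢d = c≢e ; c≢e = d≢a ; d≢a = e≢b ; e≢b = a≢c }
      where open Distinct5 D

    isLeast : Fin n → Fin n → Fin n → Fin n → Fin n → Bool
    isLeast x y z w v = lt x y ∧ lt x z ∧ lt x w ∧ lt x v

    isLeast-true : ∀ {x y z w v} → x < y → x < z → x < w → x < v → isLeast x y z w v ≡ true
    isLeast-true x<y x<z x<w x<v rewrite lt-true x<y | lt-true x<z | lt-true x<w | lt-true x<v = refl

    isLeast-false₁ : ∀ {x y} z w v → y < x → isLeast x y z w v ≡ false
    isLeast-false₁ z w v y<x rewrite lt-false y<x = refl

    isLeast-false₂ : ∀ {x z} y w v → z < x → isLeast x y z w v ≡ false
    isLeast-false₂ {x} y w v z<x rewrite lt-false z<x = ∧-zeroʳ (lt x y)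

    isLeast-false₃ : ∀ {x w} y z v → w < x → isLeast x y z w v ≡ false
    isLeast-false₃ {x} y z v w<x rewrite lt-false w<x | ∧-zeroʳ (lt x z) = ∧-zeroʳ (lt x y)

    isLeast-false₄ : ∀ {x v} y z w → v < x → isLeast x y z w v ≡ false
    isLeast-false₄ {x} y z w v<x rewrite lt-false v<x | ∧-zeroʳ (lt x w) | ∧-zeroʳ (lt x z) = ∧-zeroʳ (lt x y)

    χ-isLeast : Fin n → Fin n → Fin n → Fin n → Fin n → ℤ
    χ-isLeast x y z w v = χ (isLeast x y z w v)

    rotations-least-first : ∀ {a b c d e} → a < b → a < c → a < d → a < e → rotations χ-isLeast a b c d e ≡ 1ℤ
    rotations-least-first {a} {b} {c} {d} {e} a<b a<c a<d a<e
      rewrite isLeast-true a<b a<c a<d a<e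
            | isLeast-false₄ c d e a<b | isLeast-false₃ d e b a<c
            | isLeast-false₂ e b c a<d | isLeast-false₁ b c d a<e = refl

    strictly-least : ∀ {a b c d e} → Distinct5 a b c d e → a ≤ b → a ≤ c → a ≤ d → a ≤ e →
                     rotations χ-isLeast a b c d e ≡ 1ℤ
    strictly-least D a≤b a≤c a≤d a≤e =
      rotations-least-first (≤∧≢⇒< a≤b a≢b) (≤∧≢⇒< a≤c a≢c) (≤∧≢⇒< a≤d (d≢a ∘ sym)) (≤∧≢⇒< a≤e (e≢a ∘ sym))
      where open Distinct5 D

    unrotate : ∀ a b c d e {x} → rotations χ-isLeast b c d e a ≡ x → rotations χ-isLeast a b c d e ≡ x
    unrotate a b c d e = trans (sym (rotations-rotate χ-isLeast a b c d e))

    open import Data.List.Extrema (≤-totalOrder n) using (min; argmin-sel; min≤⊤; min≤xs)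

    rotations-least-from-minimum : ∀ {a b c d e} μ → Distinct5 a b c d e →
      μ ≡ a ⊎ μ ∈ (b ∷ c ∷ d ∷ e ∷ []) → μ ≤ a → All (μ ≤_) (b ∷ c ∷ d ∷ e ∷ []) →
      rotations χ-isLeast a b c d e ≡ 1ℤ
    rotations-least-from-minimum μ D (inj₁ refl) _ (μ≤b ∷ μ≤c ∷ μ≤d ∷ μ≤e ∷ []) =
      strictly-least D μ≤b μ≤c μ≤d μ≤e
    rotations-least-from-minimum {a} {_} {c} {d} {e} μ D (inj₂ (here refl)) μ≤a (_ ∷ μ≤c ∷ μ≤d ∷ μ≤e ∷ []) =
      unrotate a μ c d e (strictly-least (rotate D) μ≤c μ≤d μ≤e μ≤a)
    rotations-least-from-minimum {a} {b} {_} {d} {e} μ D (inj₂ (there (here refl))) μ≤a (μ≤b ∷ _ ∷ μ≤d ∷ μ≤e ∷ []) =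
      unrotate a b μ d e (unrotate b μ d e a (strictly-least (rotate (rotate D)) μ≤d μ≤e μ≤a μ≤b))
    rotations-least-from-minimum {a} {b} {c} {_} {e} μ D (inj₂ (there (there (here refl)))) μ≤a (μ≤b ∷ μ≤c ∷ _ ∷ μ≤e ∷ []) =
      unrotate a b c μ e (unrotate b c μ e a (unrotate c μ e a b
        (strictly-least (rotate (rotate (rotate D))) μ≤e μ≤a μ≤b μ≤c)))
    rotations-least-from-minimum {a} {b} {c} {d} {_} μ D (inj₂ (there (there (there (here refl))))) μ≤a (μ≤b ∷ μ≤c ∷ μ≤d ∷ _ ∷ []) =
      unrotate a b c d μ (unrotate b c d μ a (unrotate c d μ a b (unrotate d μ a b c
        (strictly-least (rotate (rotate (rotate (rotate D)))) μ≤a μ≤b μ≤c μ≤d))))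

    rotations-least : ∀ {a b c d e} → Distinct5 a b c d e → rotations χ-isLeast a b c d e ≡ 1ℤ
    rotations-least {a} {b} {c} {d} {e} D =
      rotations-least-from-minimum (min a xs) D (argmin-sel id a xs) (min≤⊤ a xs) (min≤xs a xs)
      where xs = b ∷ c ∷ d ∷ e ∷ []

  ∧-falseʳ : ∀ x {y} → y ≡ false → x ∧ y ≡ false
  ∧-falseʳ x refl = ∧-zeroʳ x

  ∧-absorbʳ : ∀ {x y z} → (z ≡ true → x ≡ true) → y ≡ z → x ∧ y ≡ z
  ∧-absorbʳ {x} {z = false} _ refl = ∧-zeroʳ x
  ∧-absorbʳ {z = true} x≡true refl rewrite x≡true refl = refl

  *-χ : ∀ {x} w → (w ≡ true → x ≡ 1ℤ) → x * χ w ≡ χ w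
  *-χ {x} true  x≡1 = trans (*-identityʳ x) (x≡1 refl)
  *-χ {x} false _   = *-zeroʳ x

  ∧⁵-rotate : ∀ x₁ x₂ x₃ x₄ x₅ → x₂ ∧ x₃ ∧ x₄ ∧ x₅ ∧ x₁ ≡ x₁ ∧ x₂ ∧ x₃ ∧ x₄ ∧ x₅
  ∧⁵-rotate true  x₂ x₃ x₄ x₅ = cong (λ y → x₂ ∧ x₃ ∧ x₄ ∧ y) (∧-identityʳ x₅)
  ∧⁵-rotate false x₂ x₃ x₄ x₅ = ∧-falseʳ x₂ (∧-falseʳ x₃ (∧-falseʳ x₄ (∧-zeroʳ x₅)))

  ∧⁵-true : ∀ {x₁ x₂ x₃ x₄ x₅} → x₁ ∧ x₂ ∧ x₃ ∧ x₄ ∧ x₅ ≡ true →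
            x₁ ≡ true × x₂ ≡ true × x₃ ≡ true × x₄ ≡ true × x₅ ≡ true
  ∧⁵-true {true} {true} {true} {true} {true} refl = refl , refl , refl , refl , refl

  module ClosedWalks {n : ℕ} (T : Tournament n) where

    isClosedWalk : Fin n → Fin n → Fin n → Fin n → Fin n → Bool
    isClosedWalk a b c d e = out T a b ∧ out T b c ∧ out T c d ∧ out T d e ∧ out T e a

    arc⇒≢ : ∀ {x y} → out T x y ≡ true → ¬ x ≡ y
    arc⇒≢ {x} x→x refl with trans (sym x→x) (irrefl T x)
    ... | ()

    arc²⇒≢ : ∀ {x y z} → out T x y ≡ true → out T y z ≡ true → ¬ x ≡ z
    arc²⇒≢ {x} {y} x→y y→x refl with trans (sym x→y) (trans (tourn T x y (arc⇒≢ x→y)) (cong not y→x))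
    ... | ()

    closedWalk-distinct : ∀ {a b c d e} → isClosedWalk a b c d e ≡ true → Distinct5 a b c d e
    closedWalk-distinct w with ∧⁵-true w
    ... | a→b , b→c , c→d , d→e , e→a = record
      { a≢b = arc⇒≢ a→b ; b≢c = arc⇒≢ b→c ; c≢d = arc⇒≢ c→d ; d≢e = arc⇒≢ d→e ; e≢a = arc⇒≢ e→a
      ; a≢c = arc²⇒≢ a→b b→c ; b≢d = arc²⇒≢ b→c c→d ; c≢e = arc²⇒≢ c→d d→e
      ; d≢a = arc²⇒≢ d→e e→a ; e≢b = arc²⇒≢ e→a a→b }

    canonical≡least∧closed : ∀ a b c d e →
      isCanonical5Cycle T a b c d e ≡ isLeast a b c d e ∧ isClosedWalk a b c d e
    canonical≡least∧closed a b c d e = begin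
      isCanonical5Cycle T a b c d e                               ≡⟨ cong (λ r → lt a b ∧ lt a c ∧ lt a d ∧ lt a e ∧ r) distinct-absorbed ⟩
      lt a b ∧ lt a c ∧ lt a d ∧ lt a e ∧ isClosedWalk a b c d e  ≡⟨ reassociate ⟨
      isLeast a b c d e ∧ isClosedWalk a b c d e                  ∎
      where
      open ≡-Reasoning
      open Distinct5
      W = isClosedWalk a b c d e
      neq-if : ∀ {x y} → (Distinct5 a b c d e → ¬ x ≡ y) → W ≡ true → neq x y ≡ true
      neq-if x≢y = neq-true ∘ x≢y ∘ closedWalk-distinct
      distinct-absorbed : neq b c ∧ neq b d ∧ neq b e ∧ neq c d ∧ neq c e ∧ neq d e ∧ W ≡ W
      distinct-absorbed =
        ∧-absorbʳ (neq-if b≢c) (∧-absorbʳ (neq-if b≢d) (∧-absorbʳ (neq-if (λ D → e≢b D ∘ sym))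
          (∧-absorbʳ (neq-if c≢d) (∧-absorbʳ (neq-if c≢e) (∧-absorbʳ (neq-if d≢e) refl)))))
      reassociate : (lt a b ∧ lt a c ∧ lt a d ∧ lt a e) ∧ W ≡ lt a b ∧ lt a c ∧ lt a d ∧ lt a e ∧ W
      reassociate = trans (∧-assoc (lt a b) _ W) (cong (lt a b ∧_) (trans (∧-assoc (lt a c) _ W)
                      (cong (lt a c ∧_) (∧-assoc (lt a d) (lt a e) W))))

    χ-canonical : Fin n → Fin n → Fin n → Fin n → Fin n → ℤ
    χ-canonical a b c d e = χ (isCanonical5Cycle T a b c d e)

    rotations-canonical : ∀ a b c d e → rotations χ-canonical a b c d e ≡ χ (isClosedWalk a b c d e)
    rotations-canonical a b c d e = begin
      rotations χ-canonical a b c d e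
        ≡⟨ cong₂ _+_ (cong₂ _+_ (cong₂ _+_ (cong₂ _+_ (term a b c d e refl) (term b c d e a w₁)) (term c d e a b w₂))
                      (term d e a b c w₃)) (term e a b c d w₄) ⟩
      χ-isLeast a b c d e * χ W + χ-isLeast b c d e a * χ W + χ-isLeast c d e a b * χ W
        + χ-isLeast d e a b c * χ W + χ-isLeast e a b c d * χ W
        ≡⟨ ring (χ-isLeast a b c d e) (χ-isLeast b c d e a) (χ-isLeast c d e a b) (χ-isLeast d e a b c) (χ-isLeast e a b c d) (χ W) ⟩
      rotations χ-isLeast a b c d e * χ W
        ≡⟨ *-χ W (rotations-least ∘ closedWalk-distinct) ⟩
      χ W
        ∎
      where
      open ≡-Reasoning
      W = isClosedWalk a b c d e
      closedWalk-rotate : ∀ a b c d e → isClosedWalk b c d e a ≡ isClosedWalk a b c d e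
      closedWalk-rotate a b c d e = ∧⁵-rotate (out T a b) (out T b c) (out T c d) (out T d e) (out T e a)
      w₁ = closedWalk-rotate a b c d e
      w₂ = trans (closedWalk-rotate b c d e a) w₁
      w₃ = trans (closedWalk-rotate c d e a b) w₂
      w₄ = trans (closedWalk-rotate d e a b c) w₃
      term : ∀ x y z u v → isClosedWalk x y z u v ≡ W → χ-canonical x y z u v ≡ χ-isLeast x y z u v * χ W
      term x y z u v eq =
        trans (cong χ (canonical≡least∧closed x y z u v)) (trans (χ-∧ (isLeast x y z u v) _) (cong (λ w → χ-isLeast x y z u v * χ w) eq))
      ring : ∀ l₀ l₁ l₂ l₃ l₄ w → l₀ * w + l₁ * w + l₂ * w + l₃ * w + l₄ * w ≡ (l₀ + l₁ + l₂ + l₃ + l₄) * w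
      ring = solve-∀

    c5≡Σ⁵ : + c5 T ≡ Σ⁵ χ-canonical
    c5≡Σ⁵ = sumFin-cong λ a → sumFin-cong λ b → sumFin-cong λ c → sumFin-cong λ d → countFin≡∑ (isCanonical5Cycle T a b c d)

    closedWalks≡5*c5 : Σ⁵ (λ a b c d e → χ (isClosedWalk a b c d e)) ≡ + 5 * + c5 T
    closedWalks≡5*c5 = begin
      Σ⁵ (λ a b c d e → χ (isClosedWalk a b c d e))   ≡⟨ Σ⁵-cong rotations-canonical ⟨
      Σ⁵ (rotations χ-canonical)                      ≡⟨ Σ⁵-rotations χ-canonical ⟩
      + 5 * Σ⁵ χ-canonical                            ≡⟨ cong (+ 5 *_) c5≡Σ⁵ ⟨
      + 5 * + c5 T                                    ∎
      where open ≡-Reasoning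

module WalkExpansion where

  open import Data.Nat.Base as ℕ using (ℕ)
  open import Data.Fin.Base using (Fin)
  open import Data.Integer.Base hiding (_^_)
  open import Data.Integer.Properties
  open import Data.Integer.Tactic.RingSolver using (solve-∀)
  open import Data.Vec.Functional using (Vector)
  open import Relation.Binary.PropositionalEquality
  open FiniteSums
  open Vectors
  open FiveCycles

  module Expansion {n : ℕ} (R : Matrix n) where

    N : ℤ
    N = + n

    𝟏 : Vector ℤ n
    𝟏 _ = 1ℤ

    walks : ℕ → ℤ
    walks k = ∑[ a < n ] (R ^ k ⊛ 𝟏) a

    closedWalks : ℕ → ℤ
    closedWalks k = ∑[ a < n ] (R ^ k ⊛ δ a) a

    path₂ : ∀ f a → ∑[ b < n ] ∑[ c < n ] (R a b * (R b c * f c)) ≡ (R ^ 2 ⊛ f) a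
    path₂ f a = sum-cong-≗ λ b → ∑-*ˡ (R a b) (λ c → R b c * f c)

    path₃ : ∀ f a → ∑[ b < n ] ∑[ c < n ] ∑[ d < n ] (R a b * (R b c * (R c d * f d))) ≡ (R ^ 3 ⊛ f) a
    path₃ f a = sum-cong-≗ λ b → trans (∑²-*ˡ (R a b) λ c d → R b c * (R c d * f d)) (cong (R a b *_) (path₂ f b))

    path₄ : ∀ f a → ∑[ b < n ] ∑[ c < n ] ∑[ d < n ] ∑[ e < n ] (R a b * (R b c * (R c d * (R d e * f e))))
                    ≡ (R ^ 4 ⊛ f) a
    path₄ f a = sum-cong-≗ λ b → trans (∑³-*ˡ (R a b) λ c d e → R b c * (R c d * (R d e * f e))) (cong (R a b *_) (path₃ f b))

    Σ²-const : ∀ x → ∑[ d < n ] ∑[ e < n ] x ≡ N * N * x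
    Σ²-const x = begin
      ∑[ d < n ] ∑[ e < n ] x   ≡⟨ ∑-const n _ ⟩
      N * ∑[ e < n ] x          ≡⟨ cong (N *_) (∑-const n x) ⟩
      N * (N * x)               ≡⟨ *-assoc N N x ⟨
      N * N * x                 ∎
      where open ≡-Reasoning

    Σ³-const : ∀ x → ∑[ c < n ] ∑[ d < n ] ∑[ e < n ] x ≡ N * N * N * x
    Σ³-const x = begin
      ∑[ c < n ] ∑[ d < n ] ∑[ e < n ] x   ≡⟨ ∑-const n _ ⟩
      N * ∑[ d < n ] ∑[ e < n ] x          ≡⟨ cong (N *_) (Σ²-const x) ⟩
      N * (N * N * x)                      ≡⟨ ring N x ⟩
      N * N * N * x                        ∎
      where
      open ≡-Reasoning
      ring : ∀ m x → m * (m * m * x) ≡ m * m * m * x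
      ring = solve-∀

    Σ⁵-walk₁ : Σ⁵ (λ a b c d e → R a b * 𝟏 b) ≡ N * N * N * walks 1
    Σ⁵-walk₁ = begin
      Σ⁵ (λ a b c d e → R a b * 𝟏 b)                   ≡⟨ sum-cong-≗ (λ a → sum-cong-≗ λ b → Σ³-const (R a b * 𝟏 b)) ⟩
      ∑[ a < n ] ∑[ b < n ] (N * N * N * (R a b * 𝟏 b)) ≡⟨ ∑²-*ˡ (N * N * N) (λ a b → R a b * 𝟏 b) ⟩
      N * N * N * walks 1                               ∎
      where open ≡-Reasoning

    Σ⁵-walk₂ : Σ⁵ (λ a b c d e → R a b * (R b c * 𝟏 c)) ≡ N * N * walks 2
    Σ⁵-walk₂ = begin
      Σ⁵ (λ a b c d e → R a b * (R b c * 𝟏 c))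
        ≡⟨ sum-cong-≗ (λ a → sum-cong-≗ λ b → sum-cong-≗ λ c → Σ²-const (R a b * (R b c * 𝟏 c))) ⟩
      ∑[ a < n ] ∑[ b < n ] ∑[ c < n ] (N * N * (R a b * (R b c * 𝟏 c)))
        ≡⟨ ∑³-*ˡ (N * N) (λ a b c → R a b * (R b c * 𝟏 c)) ⟩
      N * N * ∑[ a < n ] ∑[ b < n ] ∑[ c < n ] (R a b * (R b c * 𝟏 c))
        ≡⟨ cong (N * N *_) (sum-cong-≗ (path₂ 𝟏)) ⟩
      N * N * walks 2
        ∎
      where open ≡-Reasoning

    Σ⁵-walk₁-walk₁ : Σ⁵ (λ a b c d e → R a b * 𝟏 b * (R c d * 𝟏 d)) ≡ walks 1 * (N * walks 1)
    Σ⁵-walk₁-walk₁ = begin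
      Σ⁵ (λ a b c d e → R a b * 𝟏 b * (R c d * 𝟏 d))
        ≡⟨ sum-cong-≗ (λ a → sum-cong-≗ λ b → ∑³-*ˡ (R a b * 𝟏 b) (λ c d e → R c d * 𝟏 d)) ⟩
      ∑[ a < n ] ∑[ b < n ] (R a b * 𝟏 b * ∑[ c < n ] ∑[ d < n ] ∑[ e < n ] (R c d * 𝟏 d))
        ≡⟨ ∑²-*ʳ _ (λ a b → R a b * 𝟏 b) ⟩
      walks 1 * ∑[ c < n ] ∑[ d < n ] ∑[ e < n ] (R c d * 𝟏 d)
        ≡⟨ cong (walks 1 *_) (trans (sum-cong-≗ λ c → sum-cong-≗ λ d → ∑-const n (R c d * 𝟏 d))
                                    (∑²-*ˡ N (λ c d → R c d * 𝟏 d))) ⟩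
      walks 1 * (N * walks 1)
        ∎
      where open ≡-Reasoning

    Σ⁵-walk₃ : Σ⁵ (λ a b c d e → R a b * (R b c * (R c d * 𝟏 d))) ≡ N * walks 3
    Σ⁵-walk₃ = begin
      Σ⁵ (λ a b c d e → R a b * (R b c * (R c d * 𝟏 d)))
        ≡⟨ sum-cong-≗ (λ a → sum-cong-≗ λ b → sum-cong-≗ λ c → sum-cong-≗ λ d → ∑-const n (R a b * (R b c * (R c d * 𝟏 d)))) ⟩
      ∑[ a < n ] ∑[ b < n ] ∑[ c < n ] ∑[ d < n ] (N * (R a b * (R b c * (R c d * 𝟏 d))))
        ≡⟨ ∑⁴-*ˡ N (λ a b c d → R a b * (R b c * (R c d * 𝟏 d))) ⟩
      N * ∑[ a < n ] ∑[ b < n ] ∑[ c < n ] ∑[ d < n ] (R a b * (R b c * (R c d * 𝟏 d)))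
        ≡⟨ cong (N *_) (sum-cong-≗ (path₃ 𝟏)) ⟩
      N * walks 3
        ∎
      where open ≡-Reasoning

    Σ⁵-walk₂-walk₁ : Σ⁵ (λ a b c d e → R a b * (R b c * 𝟏 c) * (R d e * 𝟏 e)) ≡ walks 2 * walks 1
    Σ⁵-walk₂-walk₁ = begin
      Σ⁵ (λ a b c d e → R a b * (R b c * 𝟏 c) * (R d e * 𝟏 e))
        ≡⟨ sum-cong-≗ (λ a → sum-cong-≗ λ b → sum-cong-≗ λ c → ∑²-*ˡ (R a b * (R b c * 𝟏 c)) (λ d e → R d e * 𝟏 e)) ⟩
      ∑[ a < n ] ∑[ b < n ] ∑[ c < n ] (R a b * (R b c * 𝟏 c) * walks 1)
        ≡⟨ ∑³-*ʳ (walks 1) (λ a b c → R a b * (R b c * 𝟏 c)) ⟩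
      (∑[ a < n ] ∑[ b < n ] ∑[ c < n ] (R a b * (R b c * 𝟏 c))) * walks 1
        ≡⟨ cong (_* walks 1) (sum-cong-≗ (path₂ 𝟏)) ⟩
      walks 2 * walks 1
        ∎
      where open ≡-Reasoning

    Σ⁵-walk₄ : Σ⁵ (λ a b c d e → R a b * (R b c * (R c d * (R d e * 𝟏 e)))) ≡ walks 4
    Σ⁵-walk₄ = sum-cong-≗ (path₄ 𝟏)

    Σ⁵-closedWalk₅ : Σ⁵ (λ a b c d e → R a b * (R b c * (R c d * (R d e * R e a)))) ≡ closedWalks 5
    Σ⁵-closedWalk₅ = sum-cong-≗ λ a → begin
      ∑[ b < n ] ∑[ c < n ] ∑[ d < n ] ∑[ e < n ] (R a b * (R b c * (R c d * (R d e * R e a))))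
        ≡⟨ path₄ (λ e → R e a) a ⟩
      (R ^ 4 ⊛ (λ e → R e a)) a
        ≡⟨ ^-cong R 4 (λ e → sym (⊛-δ R a e)) a ⟩
      (R ^ 4 ⊛ (R ⊛ δ a)) a
        ≡⟨ ^-suc R 4 (δ a) a ⟩
      (R ^ 5 ⊛ δ a) a
        ∎
      where open ≡-Reasoning

    -- One representative of each rotation class of the monomials of degree 1 to 4 in
    -- the five edge weights of a closed walk.
    representatives : Fin n → Fin n → Fin n → Fin n → Fin n → ℤ
    representatives a b c d e =
      R a b * 𝟏 b + R a b * (R b c * 𝟏 c) + R a b * 𝟏 b * (R c d * 𝟏 d) + R a b * (R b c * (R c d * 𝟏 d))
      + R a b * (R b c * 𝟏 c) * (R d e * 𝟏 e) + R a b * (R b c * (R c d * (R d e * 𝟏 e)))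

    Σ⁵-representatives : Σ⁵ representatives
      ≡ N * N * N * walks 1 + N * N * walks 2 + walks 1 * (N * walks 1) + N * walks 3 + walks 2 * walks 1 + walks 4
    Σ⁵-representatives =
      trans (Σ⁵-distrib-+ {n} _ _) (cong₂ _+_ (trans (Σ⁵-distrib-+ {n} _ _) (cong₂ _+_ (trans (Σ⁵-distrib-+ {n} _ _)
        (cong₂ _+_ (trans (Σ⁵-distrib-+ {n} _ _) (cong₂ _+_ (trans (Σ⁵-distrib-+ {n} _ _) (cong₂ _+_
          Σ⁵-walk₁ Σ⁵-walk₂)) Σ⁵-walk₁-walk₁)) Σ⁵-walk₃)) Σ⁵-walk₂-walk₁)) Σ⁵-walk₄)

    Σ⁵-one : Σ⁵ {n} (λ a b c d e → 1ℤ) ≡ N * N * N * N * N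
    Σ⁵-one = trans (∑-const n _) (trans (cong (N *_) (trans (∑-const n _) (cong (N *_) (Σ³-const 1ℤ)))) (ring N))
      where
      ring : ∀ m → m * (m * (m * m * m * 1ℤ)) ≡ m * m * m * m * m
      ring = solve-∀

    closedWalkExpansion :
      Σ⁵ (λ a b c d e → (1ℤ + R a b) * ((1ℤ + R b c) * ((1ℤ + R c d) * ((1ℤ + R d e) * (1ℤ + R e a)))))
      ≡ N * N * N * N * N
        + + 5 * (N * N * N * walks 1 + N * N * walks 2 + walks 1 * (N * walks 1) + N * walks 3 + walks 2 * walks 1 + walks 4)
        + closedWalks 5
    closedWalkExpansion = begin
      Σ⁵ (λ a b c d e → (1ℤ + R a b) * ((1ℤ + R b c) * ((1ℤ + R c d) * ((1ℤ + R d e) * (1ℤ + R e a)))))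
        ≡⟨ Σ⁵-cong (λ a b c d e → expand (R a b) (R b c) (R c d) (R d e) (R e a)) ⟩
      Σ⁵ (λ a b c d e → 1ℤ + rotations representatives a b c d e + R a b * (R b c * (R c d * (R d e * R e a))))
        ≡⟨ trans (Σ⁵-distrib-+ (λ a b c d e → 1ℤ + rotations representatives a b c d e) cycle)
                 (cong (_+ Σ⁵ cycle) (Σ⁵-distrib-+ {n} (λ a b c d e → 1ℤ) (rotations representatives))) ⟩
      Σ⁵ {n} (λ a b c d e → 1ℤ) + Σ⁵ (rotations representatives) + Σ⁵ (λ a b c d e → R a b * (R b c * (R c d * (R d e * R e a))))
        ≡⟨ cong₂ _+_ (cong₂ _+_ Σ⁵-one (trans (Σ⁵-rotations representatives) (cong (+ 5 *_) Σ⁵-representatives)))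
                     Σ⁵-closedWalk₅ ⟩
      N * N * N * N * N
        + + 5 * (N * N * N * walks 1 + N * N * walks 2 + walks 1 * (N * walks 1) + N * walks 3 + walks 2 * walks 1 + walks 4)
        + closedWalks 5
        ∎
      where
      open ≡-Reasoning
      cycle : Fin n → Fin n → Fin n → Fin n → Fin n → ℤ
      cycle a b c d e = R a b * (R b c * (R c d * (R d e * R e a)))
      expand : ∀ x₁ x₂ x₃ x₄ x₅ → (1ℤ + x₁) * ((1ℤ + x₂) * ((1ℤ + x₃) * ((1ℤ + x₄) * (1ℤ + x₅))))
               ≡ 1ℤ + ((x₁ * 1ℤ + x₁ * (x₂ * 1ℤ) + x₁ * 1ℤ * (x₃ * 1ℤ) + x₁ * (x₂ * (x₃ * 1ℤ)) + x₁ * (x₂ * 1ℤ) * (x₄ * 1ℤ) + x₁ * (x₂ * (x₃ * (x₄ * 1ℤ))))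
                      + (x₂ * 1ℤ + x₂ * (x₃ * 1ℤ) + x₂ * 1ℤ * (x₄ * 1ℤ) + x₂ * (x₃ * (x₄ * 1ℤ)) + x₂ * (x₃ * 1ℤ) * (x₅ * 1ℤ) + x₂ * (x₃ * (x₄ * (x₅ * 1ℤ))))
                      + (x₃ * 1ℤ + x₃ * (x₄ * 1ℤ) + x₃ * 1ℤ * (x₅ * 1ℤ) + x₃ * (x₄ * (x₅ * 1ℤ)) + x₃ * (x₄ * 1ℤ) * (x₁ * 1ℤ) + x₃ * (x₄ * (x₅ * (x₁ * 1ℤ))))
                      + (x₄ * 1ℤ + x₄ * (x₅ * 1ℤ) + x₄ * 1ℤ * (x₁ * 1ℤ) + x₄ * (x₅ * (x₁ * 1ℤ)) + x₄ * (x₅ * 1ℤ) * (x₂ * 1ℤ) + x₄ * (x₅ * (x₁ * (x₂ * 1ℤ))))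
                      + (x₅ * 1ℤ + x₅ * (x₁ * 1ℤ) + x₅ * 1ℤ * (x₂ * 1ℤ) + x₅ * (x₁ * (x₂ * 1ℤ)) + x₅ * (x₁ * 1ℤ) * (x₃ * 1ℤ) + x₅ * (x₁ * (x₂ * (x₃ * 1ℤ)))))
                 + x₁ * (x₂ * (x₃ * (x₄ * x₅)))
      expand = solve-∀

module CountingIdentity where

  open import Data.Nat.Base as ℕ using (ℕ)
  open import Data.Fin.Base using (Fin)
  open import Data.Fin.Properties using () renaming (_≟_ to _≟ᶠ_)
  open import Data.Integer.Base hiding (_^_)
  open import Data.Integer.Properties
  open import Data.Integer.Tactic.RingSolver using (solve-∀)
  open import Data.List.Base using ([]; _∷_; _++_; replicate)
  open import Data.Vec.Functional using (Vector)
  open import Relation.Binary.PropositionalEquality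
  open import Relation.Nullary using (yes; no)
  open import Defs
  open FiniteSums
  open Vectors
  open FiveCycles
  open WalkExpansion

  module TournamentMatrix {n : ℕ} (T : Tournament n) where

    N : ℤ
    N = + n

    A : Matrix n
    A u v = χ (out T u v)

    A+Aᵀ : ∀ u v → A u v + A v u ≡ 1ℤ - δ u v
    A+Aᵀ u v with u ≟ᶠ v
    ... | yes refl rewrite irrefl T u | δ-refl u = refl
    ... | no u≢v   rewrite tourn T u v u≢v | δ-≢ u≢v = χ-not (out T v u)

    A*Aᵀ : ∀ u v → A u v * A v u ≡ 0ℤ
    A*Aᵀ u v with u ≟ᶠ v
    ... | yes refl rewrite irrefl T u = refl
    ... | no u≢v   rewrite tourn T u v u≢v = χ-not-* (out T v u)

    S : Matrix n
    S u v = A u v - A v u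

    S-skew : ∀ u v → S v u ≡ - S u v
    S-skew u v = ring (A u v) (A v u)
      where
      ring : ∀ x y → y - x ≡ - (x - y)
      ring = solve-∀

    S≡2A-1+δ : ∀ u v → S u v ≡ + 2 * A u v - 1ℤ + δ u v
    S≡2A-1+δ u v = begin
      A u v - A v u                      ≡⟨ cong (_-_ (A u v)) (+-solveʳ (A+Aᵀ u v)) ⟩
      A u v - (1ℤ - δ u v - A u v)       ≡⟨ ring (A u v) (δ u v) ⟩
      + 2 * A u v - 1ℤ + δ u v           ∎
      where
      open ≡-Reasoning
      ring : ∀ x d → x - (1ℤ - d - x) ≡ + 2 * x - 1ℤ + d
      ring = solve-∀

    S*S : ∀ u v → S u v * S u v ≡ 1ℤ - δ u v
    S*S u v = begin
      (A u v - A v u) * (A u v - A v u)                          ≡⟨ ring (A u v) (A v u) ⟩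
      A u v * A u v + A v u * A v u - + 2 * (A u v * A v u)      ≡⟨ cong₂ (λ x y → x + y - + 2 * (A u v * A v u)) (χ-idem (out T u v)) (χ-idem (out T v u)) ⟩
      A u v + A v u - + 2 * (A u v * A v u)                      ≡⟨ cong₂ (λ x y → x - + 2 * y) (A+Aᵀ u v) (A*Aᵀ u v) ⟩
      1ℤ - δ u v - + 2 * 0ℤ                                      ≡⟨ ring₀ (δ u v) ⟩
      1ℤ - δ u v                                                 ∎
      where
      open ≡-Reasoning
      ring : ∀ x y → (x - y) * (x - y) ≡ x * x + y * y - + 2 * (x * y)
      ring = solve-∀
      ring₀ : ∀ d → 1ℤ - d - + 2 * 0ℤ ≡ 1ℤ - d
      ring₀ = solve-∀

    open Skew S S-skew
    open SkewMoments S S-skew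
    open Polynomial S using (M-I; M-I-pow; binomialCoeffs; moments; ⟨⟩-applyPoly; moments-pad)
    open ClosedWalks T

    R : Matrix n
    R = M-I

    2A≡1+R : ∀ u v → + 2 * A u v ≡ 1ℤ + R u v
    2A≡1+R u v = trans (ring (A u v) (δ u v)) (cong (λ x → 1ℤ + (x - δ u v)) (sym (S≡2A-1+δ u v)))
      where
      ring : ∀ a d → + 2 * a ≡ 1ℤ + (+ 2 * a - 1ℤ + d - d)
      ring = solve-∀

    open Expansion R using (𝟏; walks; closedWalks; closedWalkExpansion)

    s s′ s″ : Vector ℤ n
    s  = S ⊛ 𝟏
    s′ = S ⊛ s
    s″ = S ⊛ s′

    σ τ υ : ℤ
    σ = ⟨ s , s ⟩
    τ = ⟨ s′ , s′ ⟩
    υ = ⟨ s″ , s″ ⟩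

    S² : Matrix n
    S² u v = ∑[ w < n ] (S u w * S w v)

    ‖S²‖² : ℤ
    ‖S²‖² = ∑[ a < n ] ∑[ b < n ] (S² b a * S² b a)

    ⟨𝟏,𝟏⟩ : ⟨ 𝟏 , 𝟏 ⟩ ≡ N
    ⟨𝟏,𝟏⟩ = trans (∑-const n 1ℤ) (*-identityʳ N)

    walks-moments : ∀ k → walks k ≡ moments (binomialCoeffs k) 𝟏 𝟏
    walks-moments k = begin
      ∑[ a < n ] (R ^ k ⊛ 𝟏) a                    ≡⟨ sum-cong-≗ (λ a → *-identityˡ ((R ^ k ⊛ 𝟏) a)) ⟨
      ⟨ 𝟏 , R ^ k ⊛ 𝟏 ⟩                           ≡⟨ ⟨⟩-congʳ 𝟏 (M-I-pow k 𝟏) ⟩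
      ⟨ 𝟏 , Polynomial.applyPoly S (binomialCoeffs k) 𝟏 ⟩  ≡⟨ ⟨⟩-applyPoly (binomialCoeffs k) 𝟏 𝟏 ⟩
      moments (binomialCoeffs k) 𝟏 𝟏              ∎
      where open ≡-Reasoning

    walks-value : ∀ k c₀ c₁ c₂ c₃ c₄ c₅ → binomialCoeffs k ++ replicate (5 ℕ.∸ k) 0ℤ ≡ c₀ ∷ c₁ ∷ c₂ ∷ c₃ ∷ c₄ ∷ c₅ ∷ [] →
                  walks k ≡ c₀ * N - c₂ * σ + c₄ * τ
    walks-value k c₀ c₁ c₂ c₃ c₄ c₅ coeffs = begin
      walks k                                                      ≡⟨ walks-moments k ⟩
      moments (binomialCoeffs k) 𝟏 𝟏                               ≡⟨ moments-pad (binomialCoeffs k) (5 ℕ.∸ k) 𝟏 𝟏 ⟨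
      moments (binomialCoeffs k ++ replicate (5 ℕ.∸ k) 0ℤ) 𝟏 𝟏     ≡⟨ cong (λ cs → moments cs 𝟏 𝟏) coeffs ⟩
      moments (c₀ ∷ c₁ ∷ c₂ ∷ c₃ ∷ c₄ ∷ c₅ ∷ []) 𝟏 𝟏               ≡⟨ moments-skew c₀ c₁ c₂ c₃ c₄ c₅ 𝟏 ⟩
      c₀ * ⟨ 𝟏 , 𝟏 ⟩ - c₂ * σ + c₄ * τ                             ≡⟨ cong (λ x → c₀ * x - c₂ * σ + c₄ * τ) ⟨𝟏,𝟏⟩ ⟩
      c₀ * N - c₂ * σ + c₄ * τ                                     ∎
      where open ≡-Reasoning

    walks₁ : walks 1 ≡ - N
    walks₁ = trans (walks-value 1 -1ℤ 1ℤ 0ℤ 0ℤ 0ℤ 0ℤ refl) (ring N σ τ)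
      where
      ring : ∀ x y z → -1ℤ * x - 0ℤ * y + 0ℤ * z ≡ - x
      ring = solve-∀

    walks₂ : walks 2 ≡ N - σ
    walks₂ = trans (walks-value 2 1ℤ (- + 2) 1ℤ 0ℤ 0ℤ 0ℤ refl) (ring N σ τ)
      where
      ring : ∀ x y z → 1ℤ * x - 1ℤ * y + 0ℤ * z ≡ x - y
      ring = solve-∀

    walks₃ : walks 3 ≡ + 3 * σ - N
    walks₃ = trans (walks-value 3 -1ℤ (+ 3) (- + 3) 1ℤ 0ℤ 0ℤ refl) (ring N σ τ)
      where
      ring : ∀ x y z → -1ℤ * x - (- + 3) * y + 0ℤ * z ≡ + 3 * y - x
      ring = solve-∀

    walks₄ : walks 4 ≡ τ - + 6 * σ + N
    walks₄ = trans (walks-value 4 1ℤ (- + 4) (+ 6) (- + 4) 1ℤ 0ℤ refl) (ring N σ τ)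
      where
      ring : ∀ x y z → 1ℤ * x - + 6 * y + 1ℤ * z ≡ z - + 6 * y + x
      ring = solve-∀

    ⟨δ,δ⟩ : ∀ (a : Fin n) → ⟨ δ a , δ a ⟩ ≡ 1ℤ
    ⟨δ,δ⟩ a = trans (∑-δ a (δ a)) (δ-refl a)

    ‖Sδ‖² : ∀ a → ⟨ S ⊛ δ a , S ⊛ δ a ⟩ ≡ N - 1ℤ
    ‖Sδ‖² a = begin
      ∑[ b < n ] ((S ⊛ δ a) b * (S ⊛ δ a) b)   ≡⟨ sum-cong-≗ (λ b → cong₂ _*_ (⊛-δ S a b) (⊛-δ S a b)) ⟩
      ∑[ b < n ] (S b a * S b a)               ≡⟨ sum-cong-≗ (λ b → trans (S*S b a) (cong (_-_ 1ℤ) (δ-sym b a))) ⟩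
      ∑[ b < n ] (1ℤ - δ a b)                  ≡⟨ ∑-offDiagonal a ⟩
      N - 1ℤ                                   ∎
      where open ≡-Reasoning

    ‖S²δ‖² : ∀ a → ⟨ S ^ 2 ⊛ δ a , S ^ 2 ⊛ δ a ⟩ ≡ ∑[ b < n ] (S² b a * S² b a)
    ‖S²δ‖² a = sum-cong-≗ λ b → cong₂ _*_ (⊛-cong S (⊛-δ S a) b) (⊛-cong S (⊛-δ S a) b)

    closedWalk₅-at : ∀ a → (R ^ 5 ⊛ δ a) a ≡ + 10 * N - + 11 - + 5 * ∑[ b < n ] (S² b a * S² b a)
    closedWalk₅-at a = begin
      (R ^ 5 ⊛ δ a) a                                              ≡⟨ ∑-δ a (R ^ 5 ⊛ δ a) ⟨
      ⟨ δ a , R ^ 5 ⊛ δ a ⟩                                        ≡⟨ ⟨⟩-congʳ (δ a) (M-I-pow 5 (δ a)) ⟩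
      ⟨ δ a , Polynomial.applyPoly S (binomialCoeffs 5) (δ a) ⟩    ≡⟨ ⟨⟩-applyPoly (binomialCoeffs 5) (δ a) (δ a) ⟩
      moments (-1ℤ ∷ + 5 ∷ - + 10 ∷ + 10 ∷ - + 5 ∷ 1ℤ ∷ []) (δ a) (δ a)
        ≡⟨ moments-skew -1ℤ (+ 5) (- + 10) (+ 10) (- + 5) 1ℤ (δ a) ⟩
      -1ℤ * ⟨ δ a , δ a ⟩ - (- + 10) * ⟨ S ⊛ δ a , S ⊛ δ a ⟩ + (- + 5) * ⟨ S ^ 2 ⊛ δ a , S ^ 2 ⊛ δ a ⟩
        ≡⟨ cong₂ (λ x y → -1ℤ * x - (- + 10) * y + (- + 5) * ⟨ S ^ 2 ⊛ δ a , S ^ 2 ⊛ δ a ⟩) (⟨δ,δ⟩ a) (‖Sδ‖² a) ⟩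
      -1ℤ * 1ℤ - (- + 10) * (N - 1ℤ) + (- + 5) * ⟨ S ^ 2 ⊛ δ a , S ^ 2 ⊛ δ a ⟩
        ≡⟨ cong (λ x → -1ℤ * 1ℤ - (- + 10) * (N - 1ℤ) + (- + 5) * x) (‖S²δ‖² a) ⟩
      -1ℤ * 1ℤ - (- + 10) * (N - 1ℤ) + (- + 5) * ∑[ b < n ] (S² b a * S² b a)
        ≡⟨ ring N (∑[ b < n ] (S² b a * S² b a)) ⟩
      + 10 * N - + 11 - + 5 * ∑[ b < n ] (S² b a * S² b a)
        ∎
      where
      open ≡-Reasoning
      ring : ∀ x y → -1ℤ * 1ℤ - (- + 10) * (x - 1ℤ) + (- + 5) * y ≡ + 10 * x - + 11 - + 5 * y
      ring = solve-∀

    closedWalks₅ : closedWalks 5 ≡ N * (+ 10 * N - + 11) - + 5 * ‖S²‖²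
    closedWalks₅ = begin
      ∑[ a < n ] (R ^ 5 ⊛ δ a) a
        ≡⟨ sum-cong-≗ closedWalk₅-at ⟩
      ∑[ a < n ] (+ 10 * N - + 11 - + 5 * ∑[ b < n ] (S² b a * S² b a))
        ≡⟨ ∑-distrib-sub (λ _ → + 10 * N - + 11) (λ a → + 5 * ∑[ b < n ] (S² b a * S² b a)) ⟩
      ∑[ a < n ] (+ 10 * N - + 11) - ∑[ a < n ] (+ 5 * ∑[ b < n ] (S² b a * S² b a))
        ≡⟨ cong₂ _-_ (∑-const n (+ 10 * N - + 11)) (∑-*ˡ (+ 5) λ a → ∑[ b < n ] (S² b a * S² b a)) ⟩
      N * (+ 10 * N - + 11) - + 5 * ‖S²‖²
        ∎
      where open ≡-Reasoning

    defect : ℤ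
    defect = (N * N - + 4 * N + + 6) * σ - τ + (‖S²‖² - N * N * (N - 1ℤ))

    closedWalk≡product : ∀ a b c d e → χ (isClosedWalk a b c d e) ≡ A a b * (A b c * (A c d * (A d e * A e a)))
    closedWalk≡product a b c d e =
      trans (χ-∧ (out T a b) _) (cong (A a b *_) (trans (χ-∧ (out T b c) _) (cong (A b c *_)
        (trans (χ-∧ (out T c d) _) (cong (A c d *_) (χ-∧ (out T d e) (out T e a)))))))

    160c₅≡Σ⁵ : + 160 * + c5 T ≡ Σ⁵ (λ a b c d e → (1ℤ + R a b) * ((1ℤ + R b c) * ((1ℤ + R c d) * ((1ℤ + R d e) * (1ℤ + R e a)))))
    160c₅≡Σ⁵ = begin
      + 160 * + c5 T
        ≡⟨ *-assoc (+ 32) (+ 5) (+ c5 T) ⟩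
      + 32 * (+ 5 * + c5 T)
        ≡⟨ cong (+ 32 *_) closedWalks≡5*c5 ⟨
      + 32 * Σ⁵ (λ a b c d e → χ (isClosedWalk a b c d e))
        ≡⟨ Σ⁵-*ˡ {n} (+ 32) (λ a b c d e → χ (isClosedWalk a b c d e)) ⟨
      Σ⁵ (λ a b c d e → + 32 * χ (isClosedWalk a b c d e))
        ≡⟨ Σ⁵-cong (λ a b c d e → trans (cong (+ 32 *_) (closedWalk≡product a b c d e))
                     (doubled (A a b) (A b c) (A c d) (A d e) (A e a))) ⟩
      Σ⁵ (λ a b c d e → + 2 * A a b * (+ 2 * A b c * (+ 2 * A c d * (+ 2 * A d e * (+ 2 * A e a)))))
        ≡⟨ Σ⁵-cong (λ a b c d e → cong₂ _*_ (2A≡1+R a b) (cong₂ _*_ (2A≡1+R b c) (cong₂ _*_ (2A≡1+R c d)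
                     (cong₂ _*_ (2A≡1+R d e) (2A≡1+R e a))))) ⟩
      Σ⁵ (λ a b c d e → (1ℤ + R a b) * ((1ℤ + R b c) * ((1ℤ + R c d) * ((1ℤ + R d e) * (1ℤ + R e a)))))
        ∎
      where
      open ≡-Reasoning
      doubled : ∀ x₁ x₂ x₃ x₄ x₅ → + 32 * (x₁ * (x₂ * (x₃ * (x₄ * x₅))))
                ≡ + 2 * x₁ * (+ 2 * x₂ * (+ 2 * x₃ * (+ 2 * x₄ * (+ 2 * x₅))))
      doubled = solve-∀

    160c₅≡ : + 160 * + c5 T ≡ (N + 1ℤ) * N * (N - 1ℤ) * (N - + 2) * (N - + 3) - + 5 * defect
    160c₅≡ = trans 160c₅≡Σ⁵ (trans closedWalkExpansion (evaluate walks₁ walks₂ walks₃ walks₄ closedWalks₅))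
      where
      evaluate : ∀ {w₁ w₂ w₃ w₄ c₅} → w₁ ≡ - N → w₂ ≡ N - σ → w₃ ≡ + 3 * σ - N → w₄ ≡ τ - + 6 * σ + N →
        c₅ ≡ N * (+ 10 * N - + 11) - + 5 * ‖S²‖² →
        N * N * N * N * N + + 5 * (N * N * N * w₁ + N * N * w₂ + w₁ * (N * w₁) + N * w₃ + w₂ * w₁ + w₄) + c₅
        ≡ (N + 1ℤ) * N * (N - 1ℤ) * (N - + 2) * (N - + 3) - + 5 * defect
      evaluate refl refl refl refl refl = ring N σ τ ‖S²‖²
        where
        ring : ∀ x y z w →
          x * x * x * x * x
          + + 5 * (x * x * x * - x + x * x * (x - y) + - x * (x * - x) + x * (+ 3 * y - x) + (x - y) * - x + (z - + 6 * y + x))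
          + (x * (+ 10 * x - + 11) - + 5 * w)
          ≡ (x + 1ℤ) * x * (x - 1ℤ) * (x - + 2) * (x - + 3) - + 5 * ((x * x - + 4 * x + + 6) * y - z + (w - x * x * (x - 1ℤ)))
        ring = solve-∀

module BesselBound where

  open import Data.Nat.Base as ℕ using (ℕ)
  open import Data.Fin.Base using (Fin)
  open import Data.Integer.Base hiding (_^_)
  open import Data.Integer.Properties
  open import Data.Integer.Tactic.RingSolver using (solve-∀)
  open import Function.Base using (_∘_)
  open import Relation.Binary.PropositionalEquality
  open import Defs
  open FiniteSums
  open Vectors
  open CountingIdentity

  -- The last two hypotheses are a Bessel and a Cauchy–Schwarz inequality with denominators cleared.
  bessel-cauchy-bound : ∀ {σ τ υ F} → 0ℤ ≤ σ → 0ℤ ≤ τ → (σ ≡ 0ℤ → τ ≡ 0ℤ) → 0ℤ ≤ F →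
    0ℤ ≤ σ * τ * (σ * τ * F - τ * τ - σ * υ) → 0ℤ ≤ σ * (σ * υ - τ * τ) → 0ℤ ≤ F * σ - + 2 * τ
  bessel-cauchy-bound {σ} {+0} {υ} {F} σ≥0 _ _ F≥0 _ _ =
    subst (0ℤ ≤_) (sym (+-identityʳ (F * σ))) (*-nonneg F≥0 σ≥0)
  bessel-cauchy-bound {+0} {+[1+ τ ]} _ _ σ≡0⇒τ≡0 _ _ _ with σ≡0⇒τ≡0 refl
  ... | ()
  bessel-cauchy-bound {σ@(+[1+ _ ])} {τ@(+[1+ _ ])} {υ} {F} _ _ _ _ bessel cs =
    0≤k*x⇒0≤x {τ} (+<+ (ℕ.s≤s ℕ.z≤n)) (subst (0ℤ ≤_) (ring σ τ υ F)
      (+-mono-≤ (0≤k*x⇒0≤x {σ * τ} (+<+ (ℕ.s≤s ℕ.z≤n)) bessel) (0≤k*x⇒0≤x {σ} (+<+ (ℕ.s≤s ℕ.z≤n)) cs)))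
    where
    ring : ∀ σ τ υ F → σ * τ * F - τ * τ - σ * υ + (σ * υ - τ * τ) ≡ τ * (F * σ - + 2 * τ)
    ring = solve-∀

  module SpectralBound {n : ℕ} (T : Tournament n) where
    open TournamentMatrix T
    open Skew S S-skew

    ⟨Sᵤ,Sᵤ⟩ : ∀ v → ⟨ S v , S v ⟩ ≡ N - 1ℤ
    ⟨Sᵤ,Sᵤ⟩ v = trans (sum-cong-≗ (S*S v)) (∑-offDiagonal v)

    ⟨s,s′⟩≡0 : ⟨ s , s′ ⟩ ≡ 0ℤ
    ⟨s,s′⟩≡0 = ⟨f,Sf⟩≡0 s

    ⟨s″,s⟩≡-τ : ⟨ s″ , s ⟩ ≡ - τ
    ⟨s″,s⟩≡-τ = trans (⟨⟩-comm s″ s) (⟨⟩-skew s s′)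

    rows-bessel : 0ℤ ≤ σ * τ * (σ * τ * (N * (N - 1ℤ)) - τ * τ - σ * υ)
    rows-bessel = subst (0ℤ ≤_) total (∑-nonneg (λ v → σ * τ * row v) λ v → bessel (S v) s s′ ⟨s,s′⟩≡0)
      where
      open ≡-Reasoning
      row : Fin n → ℤ
      row v = σ * τ * ⟨ S v , S v ⟩ - τ * (s′ v * s′ v) - σ * (s″ v * s″ v)
      total : ∑[ v < n ] (σ * τ * (σ * τ * ⟨ S v , S v ⟩ - τ * (s′ v * s′ v) - σ * (s″ v * s″ v)))
              ≡ σ * τ * (σ * τ * (N * (N - 1ℤ)) - τ * τ - σ * υ)
      total = begin
        ∑[ v < n ] (σ * τ * (σ * τ * ⟨ S v , S v ⟩ - τ * (s′ v * s′ v) - σ * (s″ v * s″ v)))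
          ≡⟨ ∑-*ˡ (σ * τ) row ⟩
        σ * τ * ∑[ v < n ] (σ * τ * ⟨ S v , S v ⟩ - τ * (s′ v * s′ v) - σ * (s″ v * s″ v))
          ≡⟨ cong (σ * τ *_) (trans (∑-distrib-sub (λ v → σ * τ * ⟨ S v , S v ⟩ - τ * (s′ v * s′ v)) (λ v → σ * (s″ v * s″ v)))
                                     (cong (_- ∑[ v < n ] (σ * (s″ v * s″ v)))
                                           (∑-distrib-sub (λ v → σ * τ * ⟨ S v , S v ⟩) (λ v → τ * (s′ v * s′ v))))) ⟩
        σ * τ * (∑[ v < n ] (σ * τ * ⟨ S v , S v ⟩) - ∑[ v < n ] (τ * (s′ v * s′ v)) - ∑[ v < n ] (σ * (s″ v * s″ v)))
          ≡⟨ cong (σ * τ *_) (cong₂ _-_ (cong₂ _-_ rows (∑-*ˡ τ λ v → s′ v * s′ v)) (∑-*ˡ σ λ v → s″ v * s″ v)) ⟩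
        σ * τ * (σ * τ * (N * (N - 1ℤ)) - τ * τ - σ * υ)
          ∎
        where
        rows : ∑[ v < n ] (σ * τ * ⟨ S v , S v ⟩) ≡ σ * τ * (N * (N - 1ℤ))
        rows = begin
          ∑[ v < n ] (σ * τ * ⟨ S v , S v ⟩)   ≡⟨ sum-cong-≗ (λ v → cong (σ * τ *_) (⟨Sᵤ,Sᵤ⟩ v)) ⟩
          ∑[ v < n ] (σ * τ * (N - 1ℤ))        ≡⟨ ∑-const n (σ * τ * (N - 1ℤ)) ⟩
          N * (σ * τ * (N - 1ℤ))               ≡⟨ ring N (σ * τ) ⟩
          σ * τ * (N * (N - 1ℤ))               ∎
          where
          ring : ∀ x y → x * (y * (x - 1ℤ)) ≡ y * (x * (x - 1ℤ))
          ring = solve-∀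

    score-cauchy-schwarz : 0ℤ ≤ σ * (σ * υ - τ * τ)
    score-cauchy-schwarz = subst (λ x → 0ℤ ≤ σ * (σ * υ - x)) square (cauchy-schwarz s″ s)
      where
      square : ⟨ s″ , s ⟩ * ⟨ s″ , s ⟩ ≡ τ * τ
      square = trans (cong₂ _*_ ⟨s″,s⟩≡-τ ⟨s″,s⟩≡-τ) (ring τ)
        where
        ring : ∀ x → - x * - x ≡ x * x
        ring = solve-∀

    s≗0⇒τ≡0 : (∀ v → s v ≡ 0ℤ) → τ ≡ 0ℤ
    s≗0⇒τ≡0 s≗0 = begin
      ⟨ s′ , s′ ⟩                   ≡⟨ sum-cong-≗ (λ v → cong₂ _*_ (s′≗0 v) (s′≗0 v)) ⟩
      ∑[ v < n ] (0ℤ * 0ℤ)          ≡⟨ ∑-zero n ⟩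
      0ℤ                            ∎
      where
      open ≡-Reasoning
      s′≗0 : ∀ v → s′ v ≡ 0ℤ
      s′≗0 v = trans (⊛-cong S s≗0 v) (⊛-zero S v)

    spectral-bound : 0ℤ ≤ N * (N - 1ℤ) * σ - + 2 * τ
    spectral-bound = bessel-cauchy-bound (⟨f,f⟩≥0 s) (⟨f,f⟩≥0 s′) (s≗0⇒τ≡0 ∘ ⟨f,f⟩≡0⇒f≗0 s) N[N-1]≥0
                       rows-bessel score-cauchy-schwarz
      where
      N[N-1]≥0 : 0ℤ ≤ N * (N - 1ℤ)
      N[N-1]≥0 = subst (0ℤ ≤_) (ring N) (0≤i*[i+1] (N - 1ℤ))
        where
        ring : ∀ x → (x - 1ℤ) * (x - 1ℤ + 1ℤ) ≡ x * (x - 1ℤ)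
        ring = solve-∀

module OddEntries where

  open import Data.Nat.Base as ℕ using (ℕ)
  open import Data.Fin.Base using (Fin)
  open import Data.Fin.Properties using () renaming (_≟_ to _≟ᶠ_)
  open import Data.Integer.Base hiding (_^_)
  open import Data.Integer.Properties
  open import Data.Integer.Tactic.RingSolver using (solve-∀)
  open import Data.Bool.Base using (_∧_)
  open import Relation.Binary.PropositionalEquality
  open import Relation.Nullary using (¬_; yes; no)
  open import Defs
  open FiniteSums
  open FiveCycles
  open CountingIdentity

  module ScoreIdentities {n : ℕ} (T : Tournament n) where
    open TournamentMatrix T

    outdeg≡ : ∀ v → + outdeg T v ≡ ∑[ w < n ] A v w
    outdeg≡ v = countFin≡∑ (out T v)

    jointOut≡ : ∀ u v → + jointOut T u v ≡ ∑[ w < n ] (A u w * A v w)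
    jointOut≡ u v = trans (countFin≡∑ (λ w → out T u w ∧ out T v w)) (sum-cong-≗ λ w → χ-∧ (out T u w) (out T v w))

    s≡2d-N+1 : ∀ v → s v ≡ + 2 * + outdeg T v - N + 1ℤ
    s≡2d-N+1 v = begin
      ∑[ w < n ] (S v w * 1ℤ)                                      ≡⟨ sum-cong-≗ (λ w → trans (*-identityʳ (S v w)) (S≡2A-1+δ v w)) ⟩
      ∑[ w < n ] (+ 2 * A v w - 1ℤ + δ v w)                        ≡⟨ ∑-distrib-+ (λ w → + 2 * A v w - 1ℤ) (δ v) ⟩
      ∑[ w < n ] (+ 2 * A v w - 1ℤ) + ∑[ w < n ] δ v w              ≡⟨ cong₂ _+_ (∑-distrib-sub (λ w → + 2 * A v w) (λ _ → 1ℤ)) ∑δ≡1 ⟩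
      ∑[ w < n ] (+ 2 * A v w) - ∑[ w < n ] 1ℤ + 1ℤ                ≡⟨ cong₂ (λ x y → x - y + 1ℤ) (∑-*ˡ (+ 2) (A v)) (trans (∑-const n 1ℤ) (*-identityʳ N)) ⟩
      + 2 * ∑[ w < n ] A v w - N + 1ℤ                              ≡⟨ cong (λ d → + 2 * d - N + 1ℤ) (outdeg≡ v) ⟨
      + 2 * + outdeg T v - N + 1ℤ                                  ∎
      where
      open ≡-Reasoning
      ∑δ≡1 : ∑[ w < n ] δ v w ≡ 1ℤ
      ∑δ≡1 = trans (sum-cong-≗ λ w → sym (*-identityʳ (δ v w))) (∑-δ v (λ _ → 1ℤ))

    S²-diag : ∀ v → S² v v ≡ - (N - 1ℤ)
    S²-diag v = begin
      ∑[ w < n ] (S v w * S w v)         ≡⟨ sum-cong-≗ (λ w → trans (cong (S v w *_) (S-skew v w)) (sym (neg-distribʳ-* (S v w) (S v w)))) ⟩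
      ∑[ w < n ] (- (S v w * S v w))     ≡⟨ ∑-neg (λ w → S v w * S v w) ⟩
      - ∑[ w < n ] (S v w * S v w)       ≡⟨ cong -_ (trans (sum-cong-≗ (S*S v)) (∑-offDiagonal v)) ⟩
      - (N - 1ℤ)                         ∎
      where open ≡-Reasoning

    s≡2∑A-N+1 : ∀ v → s v ≡ + 2 * ∑[ w < n ] A v w - N + 1ℤ
    s≡2∑A-N+1 v = trans (s≡2d-N+1 v) (cong (λ d → + 2 * d - N + 1ℤ) (outdeg≡ v))

    S·S+4A·A : ∀ u v w → S u w * S w v + + 4 * (A u w * A v w)
               ≡ + 2 * (A u w * (1ℤ - δ v w)) + + 2 * (A v w * (1ℤ - δ u w)) - (1ℤ - δ u w) * (1ℤ - δ v w)
    S·S+4A·A u v w = begin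
      S u w * S w v + + 4 * (A u w * A v w)
        ≡⟨ cong (λ x → S u w * x + + 4 * (A u w * A v w)) (S-skew v w) ⟩
      S u w * - S v w + + 4 * (A u w * A v w)
        ≡⟨ cong₂ (λ x y → x * - y + + 4 * (A u w * A v w)) (S≡2A-1+δ u w) (S≡2A-1+δ v w) ⟩
      (+ 2 * A u w - 1ℤ + δ u w) * - (+ 2 * A v w - 1ℤ + δ v w) + + 4 * (A u w * A v w)
        ≡⟨ ring (A u w) (A v w) (δ u w) (δ v w) ⟩
      + 2 * (A u w * (1ℤ - δ v w)) + + 2 * (A v w * (1ℤ - δ u w)) - (1ℤ - δ u w) * (1ℤ - δ v w)
        ∎
      where
      open ≡-Reasoning
      ring : ∀ a b d₁ d₂ → (+ 2 * a - 1ℤ + d₁) * - (+ 2 * b - 1ℤ + d₂) + + 4 * (a * b)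
             ≡ + 2 * (a * (1ℤ - d₂)) + + 2 * (b * (1ℤ - d₁)) - (1ℤ - d₁) * (1ℤ - d₂)
      ring = solve-∀

    S²+4J : ∀ u v → ¬ u ≡ v → S² u v + + 4 * + jointOut T u v ≡ s u + s v + N - + 2
    S²+4J u v u≢v = begin
      S² u v + + 4 * + jointOut T u v
        ≡⟨ cong (λ j → S² u v + + 4 * j) (jointOut≡ u v) ⟩
      S² u v + + 4 * ∑[ w < n ] (A u w * A v w)
        ≡⟨ cong (_+_ (S² u v)) (∑-*ˡ (+ 4) (λ w → A u w * A v w)) ⟨
      ∑[ w < n ] (S u w * S w v) + ∑[ w < n ] (+ 4 * (A u w * A v w))
        ≡⟨ ∑-distrib-+ (λ w → S u w * S w v) (λ w → + 4 * (A u w * A v w)) ⟨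
      ∑[ w < n ] (S u w * S w v + + 4 * (A u w * A v w))
        ≡⟨ sum-cong-≗ (S·S+4A·A u v) ⟩
      ∑[ w < n ] (+ 2 * X w + + 2 * Y w - Z w)
        ≡⟨ ∑-distrib-sub (λ w → + 2 * X w + + 2 * Y w) Z ⟩
      ∑[ w < n ] (+ 2 * X w + + 2 * Y w) - ∑[ w < n ] Z w
        ≡⟨ cong (_- ∑[ w < n ] Z w) (trans (∑-distrib-+ (λ w → + 2 * X w) (λ w → + 2 * Y w)) (cong₂ _+_ (∑-*ˡ (+ 2) X) (∑-*ˡ (+ 2) Y))) ⟩
      + 2 * ∑[ w < n ] X w + + 2 * ∑[ w < n ] Y w - ∑[ w < n ] Z w
        ≡⟨ cong₂ (λ x y → + 2 * x + + 2 * y - ∑[ w < n ] Z w) (∑-*-offDiagonal v (A u)) (∑-*-offDiagonal u (A v)) ⟩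
      + 2 * (dᵤ - A u v) + + 2 * (dᵥ - A v u) - ∑[ w < n ] Z w
        ≡⟨ cong (λ z → + 2 * (dᵤ - A u v) + + 2 * (dᵥ - A v u) - z)
                (trans (∑-*-offDiagonal v (λ w → 1ℤ - δ u w)) (cong₂ _-_ (∑-offDiagonal u) (cong (_-_ 1ℤ) (δ-≢ u≢v)))) ⟩
      + 2 * (dᵤ - A u v) + + 2 * (dᵥ - A v u) - (N - 1ℤ - (1ℤ - 0ℤ))
        ≡⟨ ring dᵤ dᵥ (A u v) (A v u) N (trans (A+Aᵀ u v) (cong (_-_ 1ℤ) (δ-≢ u≢v))) ⟩
      + 2 * dᵤ - N + 1ℤ + (+ 2 * dᵥ - N + 1ℤ) + N - + 2
        ≡⟨ cong₂ (λ x y → x + y + N - + 2) (s≡2∑A-N+1 u) (s≡2∑A-N+1 v) ⟨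
      s u + s v + N - + 2
        ∎
      where
      open ≡-Reasoning
      dᵤ = ∑[ w < n ] A u w
      dᵥ = ∑[ w < n ] A v w
      X Y Z : Fin n → ℤ
      X w = A u w * (1ℤ - δ v w)
      Y w = A v w * (1ℤ - δ u w)
      Z w = (1ℤ - δ u w) * (1ℤ - δ v w)
      ring : ∀ d₁ d₂ a b x → a + b ≡ 1ℤ - 0ℤ →
             + 2 * (d₁ - a) + + 2 * (d₂ - b) - (x - 1ℤ - (1ℤ - 0ℤ)) ≡ + 2 * d₁ - x + 1ℤ + (+ 2 * d₂ - x + 1ℤ) + x - + 2
      ring d₁ d₂ a b x a+b≡1 =
        trans (cong (λ y → + 2 * (d₁ - a) + + 2 * (d₂ - y) - (x - 1ℤ - (1ℤ - 0ℤ))) (+-solveʳ {a} a+b≡1)) (ring′ d₁ d₂ a x)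
        where
        ring′ : ∀ d₁ d₂ a x → + 2 * (d₁ - a) + + 2 * (d₂ - (1ℤ - 0ℤ - a)) - (x - 1ℤ - (1ℤ - 0ℤ))
                              ≡ + 2 * d₁ - x + 1ℤ + (+ 2 * d₂ - x + 1ℤ) + x - + 2
        ring′ = solve-∀

    excess : Fin n → Fin n → ℤ
    excess u v = S² u v * S² u v - δ u v * ((N - 1ℤ) * (N - 1ℤ)) - (1ℤ - δ u v)

    excess-diag : ∀ v → excess v v ≡ 0ℤ
    excess-diag v = trans (cong₂ (λ x d → x * x - d * ((N - 1ℤ) * (N - 1ℤ)) - (1ℤ - d)) (S²-diag v) (δ-refl v)) (ring N)
      where
      ring : ∀ x → - (x - 1ℤ) * - (x - 1ℤ) - 1ℤ * ((x - 1ℤ) * (x - 1ℤ)) - (1ℤ - 1ℤ) ≡ 0ℤ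
      ring = solve-∀

    ∑excess : ∑[ a < n ] ∑[ b < n ] excess b a ≡ ‖S²‖² - N * N * (N - 1ℤ)
    ∑excess = begin
      ∑[ a < n ] ∑[ b < n ] excess b a
        ≡⟨ sum-cong-≗ (λ a → columnSum a) ⟩
      ∑[ a < n ] (∑[ b < n ] (S² b a * S² b a) - N * (N - 1ℤ))
        ≡⟨ ∑-distrib-sub (λ a → ∑[ b < n ] (S² b a * S² b a)) (λ _ → N * (N - 1ℤ)) ⟩
      ‖S²‖² - ∑[ a < n ] (N * (N - 1ℤ))
        ≡⟨ cong (_-_ ‖S²‖²) (trans (∑-const n (N * (N - 1ℤ))) (sym (*-assoc N N (N - 1ℤ)))) ⟩
      ‖S²‖² - N * N * (N - 1ℤ)
        ∎
      where
      open ≡-Reasoning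
      columnSum : ∀ a → ∑[ b < n ] excess b a ≡ ∑[ b < n ] (S² b a * S² b a) - N * (N - 1ℤ)
      columnSum a = begin
        ∑[ b < n ] (S² b a * S² b a - δ b a * ((N - 1ℤ) * (N - 1ℤ)) - (1ℤ - δ b a))
          ≡⟨ ∑-distrib-sub (λ b → S² b a * S² b a - δ b a * ((N - 1ℤ) * (N - 1ℤ))) (λ b → 1ℤ - δ b a) ⟩
        ∑[ b < n ] (S² b a * S² b a - δ b a * ((N - 1ℤ) * (N - 1ℤ))) - ∑[ b < n ] (1ℤ - δ b a)
          ≡⟨ cong₂ _-_ (∑-distrib-sub (λ b → S² b a * S² b a) (λ b → δ b a * ((N - 1ℤ) * (N - 1ℤ))))
                       (trans (sum-cong-≗ λ b → cong (_-_ 1ℤ) (δ-sym b a)) (∑-offDiagonal a)) ⟩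
        ∑[ b < n ] (S² b a * S² b a) - ∑[ b < n ] (δ b a * ((N - 1ℤ) * (N - 1ℤ))) - (N - 1ℤ)
          ≡⟨ cong (λ x → ∑[ b < n ] (S² b a * S² b a) - x - (N - 1ℤ))
                  (trans (sum-cong-≗ λ b → cong (_* ((N - 1ℤ) * (N - 1ℤ))) (δ-sym b a)) (∑-δ a (λ _ → (N - 1ℤ) * (N - 1ℤ)))) ⟩
        ∑[ b < n ] (S² b a * S² b a) - (N - 1ℤ) * (N - 1ℤ) - (N - 1ℤ)
          ≡⟨ ring (∑[ b < n ] (S² b a * S² b a)) N ⟩
        ∑[ b < n ] (S² b a * S² b a) - N * (N - 1ℤ)
          ∎
        where
        ring : ∀ m x → m - (x - 1ℤ) * (x - 1ℤ) - (x - 1ℤ) ≡ m - x * (x - 1ℤ)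
        ring = solve-∀

    module OddOrder (K : ℤ) (N≡1+2K : N ≡ 1ℤ + + 2 * K) where

      -- Off the diagonal S² has odd entries, since the scores sᵤ = 2dᵤ - 2K are even.
      half : Fin n → Fin n → ℤ
      half u v = + outdeg T u + + outdeg T v - K - + 2 * + jointOut T u v - 1ℤ

      S²-odd : ∀ u v → ¬ u ≡ v → S² u v ≡ + 2 * half u v + 1ℤ
      S²-odd u v u≢v = begin
        S² u v                                                   ≡⟨ +-solveˡ (S²+4J u v u≢v) ⟩
        s u + s v + N - + 2 - + 4 * + jointOut T u v             ≡⟨ cong₂ (λ x y → x + y + N - + 2 - + 4 * + jointOut T u v) (s≡2d-N+1 u) (s≡2d-N+1 v) ⟩
        + 2 * dᵤ - N + 1ℤ + (+ 2 * dᵥ - N + 1ℤ) + N - + 2 - + 4 * jᵤᵥ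
                                                                 ≡⟨ cong (λ x → + 2 * dᵤ - x + 1ℤ + (+ 2 * dᵥ - x + 1ℤ) + x - + 2 - + 4 * jᵤᵥ) N≡1+2K ⟩
        + 2 * dᵤ - (1ℤ + + 2 * K) + 1ℤ + (+ 2 * dᵥ - (1ℤ + + 2 * K) + 1ℤ) + (1ℤ + + 2 * K) - + 2 - + 4 * jᵤᵥ
                                                                 ≡⟨ ring dᵤ dᵥ K jᵤᵥ ⟩
        + 2 * half u v + 1ℤ                                      ∎
        where
        open ≡-Reasoning
        dᵤ = + outdeg T u
        dᵥ = + outdeg T v
        jᵤᵥ = + jointOut T u v
        ring : ∀ a b k j → + 2 * a - (1ℤ + + 2 * k) + 1ℤ + (+ 2 * b - (1ℤ + + 2 * k) + 1ℤ) + (1ℤ + + 2 * k) - + 2 - + 4 * j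
                           ≡ + 2 * (a + b - k - + 2 * j - 1ℤ) + 1ℤ
        ring = solve-∀

      excess-off : ∀ u v → ¬ u ≡ v → excess u v ≡ + 4 * (half u v * (half u v + 1ℤ))
      excess-off u v u≢v =
        trans (cong₂ (λ x d → x * x - d * ((N - 1ℤ) * (N - 1ℤ)) - (1ℤ - d)) (S²-odd u v u≢v) (δ-≢ u≢v)) (ring (half u v) N)
        where
        ring : ∀ j x → (+ 2 * j + 1ℤ) * (+ 2 * j + 1ℤ) - 0ℤ * ((x - 1ℤ) * (x - 1ℤ)) - (1ℤ - 0ℤ) ≡ + 4 * (j * (j + 1ℤ))
        ring = solve-∀

      excess≥0 : ∀ u v → 0ℤ ≤ excess u v
      excess≥0 u v with u ≟ᶠ v
      ... | yes refl = subst (0ℤ ≤_) (sym (excess-diag u)) ≤-refl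
      ... | no u≢v   = subst (0ℤ ≤_) (sym (excess-off u v u≢v)) (*-nonneg {+ 4} (+≤+ ℕ.z≤n) (0≤i*[i+1] (half u v)))

      ‖S²‖²≥ : 0ℤ ≤ ‖S²‖² - N * N * (N - 1ℤ)
      ‖S²‖²≥ = subst (0ℤ ≤_) ∑excess
        (∑-nonneg (λ a → ∑[ b < n ] excess b a) λ a → ∑-nonneg (λ b → excess b a) λ b → excess≥0 b a)

module EqualityCase where

  open import Data.Nat.Base as ℕ using (ℕ)
  open import Data.Fin.Base using (Fin)
  open import Data.Fin.Properties using () renaming (_≟_ to _≟ᶠ_)
  open import Data.Integer.Base hiding (_^_)
  open import Data.Integer.Properties
  open import Data.Integer.Tactic.RingSolver using (solve-∀)
  open import Data.Product.Base using (_×_; _,_; proj₁; proj₂)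
  open import Relation.Binary.PropositionalEquality
  open import Relation.Nullary using (¬_; yes; no)
  open import Defs
  open FiniteSums
  open Vectors
  open CountingIdentity
  open BesselBound
  open OddEntries

  module Defect {n : ℕ} (T : Tournament n) where
    open TournamentMatrix T
    open SpectralBound T
    open ScoreIdentities T

    2*defect : + 2 * defect ≡ (N - + 3) * (N - + 4) * σ + (N * (N - 1ℤ) * σ - + 2 * τ) + + 2 * (‖S²‖² - N * N * (N - 1ℤ))
    2*defect = ring N σ τ ‖S²‖²
      where
      ring : ∀ x y z w → + 2 * ((x * x - + 4 * x + + 6) * y - z + (w - x * x * (x - 1ℤ)))
                         ≡ (x - + 3) * (x - + 4) * y + (x * (x - 1ℤ) * y - + 2 * z) + + 2 * (w - x * x * (x - 1ℤ))
      ring = solve-∀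

    [N-3][N-4]σ≥0 : 0ℤ ≤ (N - + 3) * (N - + 4) * σ
    [N-3][N-4]σ≥0 = *-nonneg (subst (0ℤ ≤_) (ring N) (0≤i*[i+1] (N - + 4))) (⟨f,f⟩≥0 s)
      where
      ring : ∀ x → (x - + 4) * (x - + 4 + 1ℤ) ≡ (x - + 3) * (x - + 4)
      ring = solve-∀

    s≗0⇒regular : (∀ v → s v ≡ 0ℤ) → IsRegular T
    s≗0⇒regular s≗0 v = +-injective (begin
      + (2 ℕ.* outdeg T v ℕ.+ 1)        ≡⟨ pos-+ (2 ℕ.* outdeg T v) 1 ⟩
      + (2 ℕ.* outdeg T v) + 1ℤ         ≡⟨ cong (_+ 1ℤ) (pos-* 2 (outdeg T v)) ⟩
      + 2 * + outdeg T v + 1ℤ           ≡⟨ ring (+ 2 * + outdeg T v) N ⟩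
      N + (+ 2 * + outdeg T v - N + 1ℤ) ≡⟨ cong (_+_ N) (trans (sym (s≡2d-N+1 v)) (s≗0 v)) ⟩
      N + 0ℤ                            ≡⟨ +-identityʳ N ⟩
      N                                 ∎)
      where
      open ≡-Reasoning
      ring : ∀ x y → x + 1ℤ ≡ y + (x - y + 1ℤ)
      ring = solve-∀

    regular⇒s≗0 : IsRegular T → ∀ v → s v ≡ 0ℤ
    regular⇒s≗0 regular v = begin
      s v                               ≡⟨ s≡2d-N+1 v ⟩
      + 2 * + outdeg T v - N + 1ℤ       ≡⟨ cong (λ x → + 2 * + outdeg T v - x + 1ℤ) N≡2d+1 ⟨
      + 2 * + outdeg T v - (+ 2 * + outdeg T v + 1ℤ) + 1ℤ   ≡⟨ ring (+ 2 * + outdeg T v) ⟩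
      0ℤ                                ∎
      where
      open ≡-Reasoning
      N≡2d+1 : + 2 * + outdeg T v + 1ℤ ≡ N
      N≡2d+1 = trans (cong (_+ 1ℤ) (sym (pos-* 2 (outdeg T v)))) (trans (sym (pos-+ (2 ℕ.* outdeg T v) 1)) (cong +_ (regular v)))
      ring : ∀ x → x - (x + 1ℤ) + 1ℤ ≡ 0ℤ
      ring = solve-∀

    ∑S²-row : ∀ u → ∑[ v < n ] S² u v ≡ s′ u
    ∑S²-row u = begin
      ∑[ v < n ] ∑[ w < n ] (S u w * S w v)     ≡⟨ ∑-comm (λ v w → S u w * S w v) ⟩
      ∑[ w < n ] ∑[ v < n ] (S u w * S w v)     ≡⟨ sum-cong-≗ (λ w → ∑-*ˡ (S u w) (S w)) ⟩
      ∑[ w < n ] (S u w * ∑[ v < n ] S w v)     ≡⟨ sum-cong-≗ (λ w → cong (S u w *_) (sum-cong-≗ λ v → sym (*-identityʳ (S w v)))) ⟩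
      s′ u                                      ∎
      where open ≡-Reasoning

    slack : Fin n → Fin n → ℤ
    slack u v = (1ℤ - δ u v) - S² u v - δ u v * (N - 1ℤ)

    slack-diag : ∀ v → slack v v ≡ 0ℤ
    slack-diag v = trans (cong₂ (λ d x → (1ℤ - d) - x - d * (N - 1ℤ)) (δ-refl v) (S²-diag v)) (ring N)
      where
      ring : ∀ x → (1ℤ - 1ℤ) - - (x - 1ℤ) - 1ℤ * (x - 1ℤ) ≡ 0ℤ
      ring = solve-∀

    slack-off : ∀ u v → ¬ u ≡ v → slack u v ≡ 1ℤ - S² u v
    slack-off u v u≢v = trans (cong (λ d → (1ℤ - d) - S² u v - d * (N - 1ℤ)) (δ-≢ u≢v)) (ring (S² u v) N)
      where
      ring : ∀ y x → (1ℤ - 0ℤ) - y - 0ℤ * (x - 1ℤ) ≡ 1ℤ - y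
      ring = solve-∀

    ∑slack : ∀ u → ∑[ v < n ] slack u v ≡ - s′ u
    ∑slack u = begin
      ∑[ v < n ] ((1ℤ - δ u v) - S² u v - δ u v * (N - 1ℤ))
        ≡⟨ ∑-distrib-sub (λ v → (1ℤ - δ u v) - S² u v) (λ v → δ u v * (N - 1ℤ)) ⟩
      ∑[ v < n ] ((1ℤ - δ u v) - S² u v) - ∑[ v < n ] (δ u v * (N - 1ℤ))
        ≡⟨ cong₂ _-_ (∑-distrib-sub (λ v → 1ℤ - δ u v) (S² u)) (∑-δ u (λ _ → N - 1ℤ)) ⟩
      ∑[ v < n ] (1ℤ - δ u v) - ∑[ v < n ] S² u v - (N - 1ℤ)
        ≡⟨ cong₂ (λ x y → x - y - (N - 1ℤ)) (∑-offDiagonal u) (∑S²-row u) ⟩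
      N - 1ℤ - s′ u - (N - 1ℤ)
        ≡⟨ ring N (s′ u) ⟩
      - s′ u
        ∎
      where
      open ≡-Reasoning
      ring : ∀ x y → x - 1ℤ - y - (x - 1ℤ) ≡ - y
      ring = solve-∀

    pos-4j+3 : ∀ u v → + (4 ℕ.* jointOut T u v ℕ.+ 3) ≡ + 4 * + jointOut T u v + + 3
    pos-4j+3 u v = trans (pos-+ (4 ℕ.* jointOut T u v) 3) (cong (_+ + 3) (pos-* 4 (jointOut T u v)))

    module Regular (s≗0 : ∀ v → s v ≡ 0ℤ) where

      σ≡0 : σ ≡ 0ℤ
      σ≡0 = trans (sum-cong-≗ λ v → cong₂ _*_ (s≗0 v) (s≗0 v)) (∑-zero n)

      S²+4J≡N-2 : ∀ u v → ¬ u ≡ v → S² u v + + 4 * + jointOut T u v ≡ N - + 2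
      S²+4J≡N-2 u v u≢v = trans (S²+4J u v u≢v) (trans (cong₂ (λ x y → x + y + N - + 2) (s≗0 u) (s≗0 v)) (ring N))
        where
        ring : ∀ x → 0ℤ + 0ℤ + x - + 2 ≡ x - + 2
        ring = solve-∀

      S²≡1⇒jointOut : ∀ u v → ¬ u ≡ v → S² u v ≡ 1ℤ → 4 ℕ.* jointOut T u v ℕ.+ 3 ≡ n
      S²≡1⇒jointOut u v u≢v S²≡1 = +-injective (begin
        + (4 ℕ.* jointOut T u v ℕ.+ 3)      ≡⟨ pos-4j+3 u v ⟩
        + 4 * jᵤᵥ + + 3                     ≡⟨ ring jᵤᵥ ⟩
        1ℤ + + 4 * jᵤᵥ + + 2                ≡⟨ cong (λ x → x + + 4 * jᵤᵥ + + 2) S²≡1 ⟨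
        S² u v + + 4 * jᵤᵥ + + 2            ≡⟨ cong (_+ + 2) (S²+4J≡N-2 u v u≢v) ⟩
        N - + 2 + + 2                       ≡⟨ ring′ N ⟩
        N                                   ∎)
        where
        open ≡-Reasoning
        jᵤᵥ = + jointOut T u v
        ring : ∀ j → + 4 * j + + 3 ≡ 1ℤ + + 4 * j + + 2
        ring = solve-∀
        ring′ : ∀ x → x - + 2 + + 2 ≡ x
        ring′ = solve-∀

      jointOut⇒S²≡1 : ∀ u v → ¬ u ≡ v → 4 ℕ.* jointOut T u v ℕ.+ 3 ≡ n → S² u v ≡ 1ℤ
      jointOut⇒S²≡1 u v u≢v 4j+3≡n = begin
        S² u v                              ≡⟨ +-solveˡ (S²+4J≡N-2 u v u≢v) ⟩
        N - + 2 - + 4 * jᵤᵥ                 ≡⟨ cong (λ x → x - + 2 - + 4 * jᵤᵥ) (trans (cong +_ (sym 4j+3≡n)) (pos-4j+3 u v)) ⟩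
        + 4 * jᵤᵥ + + 3 - + 2 - + 4 * jᵤᵥ   ≡⟨ ring jᵤᵥ ⟩
        1ℤ                                  ∎
        where
        open ≡-Reasoning
        jᵤᵥ = + jointOut T u v
        ring : ∀ j → + 4 * j + + 3 - + 2 - + 4 * j ≡ 1ℤ
        ring = solve-∀

      S²≡1⇒defect≡0 : (∀ u v → ¬ u ≡ v → S² u v ≡ 1ℤ) → defect ≡ 0ℤ
      S²≡1⇒defect≡0 S²≡1 = begin
        (N * N - + 4 * N + + 6) * σ - τ + (‖S²‖² - N * N * (N - 1ℤ))
          ≡⟨ cong₂ (λ x y → (N * N - + 4 * N + + 6) * x - y + (‖S²‖² - N * N * (N - 1ℤ))) σ≡0 (s≗0⇒τ≡0 s≗0) ⟩
        (N * N - + 4 * N + + 6) * 0ℤ - 0ℤ + (‖S²‖² - N * N * (N - 1ℤ))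
          ≡⟨ cong (λ x → (N * N - + 4 * N + + 6) * 0ℤ - 0ℤ + x) (trans (sym ∑excess) ∑excess≡0) ⟩
        (N * N - + 4 * N + + 6) * 0ℤ - 0ℤ + 0ℤ
          ≡⟨ ring N ⟩
        0ℤ
          ∎
        where
        open ≡-Reasoning
        excess≡0 : ∀ u v → excess u v ≡ 0ℤ
        excess≡0 u v with u ≟ᶠ v
        ... | yes refl = excess-diag u
        ... | no u≢v   = trans (cong₂ (λ x d → x * x - d * ((N - 1ℤ) * (N - 1ℤ)) - (1ℤ - d)) (S²≡1 u v u≢v) (δ-≢ u≢v)) (ring₁ N)
          where
          ring₁ : ∀ x → 1ℤ * 1ℤ - 0ℤ * ((x - 1ℤ) * (x - 1ℤ)) - (1ℤ - 0ℤ) ≡ 0ℤ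
          ring₁ = solve-∀
        ∑excess≡0 : ∑[ a < n ] ∑[ b < n ] excess b a ≡ 0ℤ
        ∑excess≡0 = trans (sum-cong-≗ λ a → trans (sum-cong-≗ λ b → excess≡0 b a) (∑-zero n)) (∑-zero n)
        ring : ∀ x → (x * x - + 4 * x + + 6) * 0ℤ - 0ℤ + 0ℤ ≡ 0ℤ
        ring = solve-∀

      ∑slack≡0 : ∀ u → ∑[ v < n ] slack u v ≡ 0ℤ
      ∑slack≡0 u = trans (∑slack u) (cong -_ (trans (⊛-cong S s≗0 u) (⊛-zero S u)))

    doublyRegular⇒defect≡0 : IsDoublyRegular T → defect ≡ 0ℤ
    doublyRegular⇒defect≡0 (regular , joint) =
      S²≡1⇒defect≡0 (λ u v u≢v → jointOut⇒S²≡1 u v u≢v (joint u v u≢v))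
      where open Regular (regular⇒s≗0 regular)

    module OddDefect (K : ℤ) (N≡1+2K : N ≡ 1ℤ + + 2 * K) where
      open OddOrder K N≡1+2K

      defect-parts≥0 : 0ℤ ≤ (N - + 3) * (N - + 4) * σ + (N * (N - 1ℤ) * σ - + 2 * τ)
      defect-parts≥0 = +-mono-≤ [N-3][N-4]σ≥0 spectral-bound

      defect≥0 : 0ℤ ≤ defect
      defect≥0 = 0≤k*x⇒0≤x {+ 2} (+<+ (ℕ.s≤s ℕ.z≤n)) (subst (0ℤ ≤_) (sym 2*defect)
                   (+-mono-≤ defect-parts≥0 (*-nonneg {+ 2} (+≤+ ℕ.z≤n) ‖S²‖²≥)))

      slack≥0 : ∀ u v → excess u v ≡ 0ℤ → 0ℤ ≤ slack u v
      slack≥0 u v excess≡0 with u ≟ᶠ v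
      ... | yes refl = subst (0ℤ ≤_) (sym (slack-diag u)) ≤-refl
      ... | no u≢v   = subst (0ℤ ≤_) (sym (trans (slack-off u v u≢v) 1-S²≡-2j)) (i*[i+1]≡0⇒0≤-2i j[j+1]≡0)
        where
        j[j+1]≡0 : half u v * (half u v + 1ℤ) ≡ 0ℤ
        j[j+1]≡0 = k*i≡0⇒i≡0 {+ 4} (+<+ (ℕ.s≤s ℕ.z≤n)) (trans (sym (excess-off u v u≢v)) excess≡0)
        1-S²≡-2j : 1ℤ - S² u v ≡ - (+ 2 * half u v)
        1-S²≡-2j = trans (cong (_-_ 1ℤ) (S²-odd u v u≢v)) (ring (half u v))
          where
          ring : ∀ j → 1ℤ - (+ 2 * j + 1ℤ) ≡ - (+ 2 * j)
          ring = solve-∀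

      defect≡0⇒doublyRegular : 0ℤ < (N - + 3) * (N - + 4) → defect ≡ 0ℤ → IsDoublyRegular T
      defect≡0⇒doublyRegular N>4 defect≡0 = s≗0⇒regular s≗0 , λ u v u≢v → S²≡1⇒jointOut u v u≢v (S²≡1 u v u≢v)
        where
        parts = +-nonneg-≡0 defect-parts≥0 (*-nonneg {+ 2} (+≤+ ℕ.z≤n) ‖S²‖²≥)
                  (trans (sym 2*defect) (trans (cong (+ 2 *_) defect≡0) (*-zeroʳ (+ 2))))
        s≗0 = ⟨f,f⟩≡0⇒f≗0 s (k*i≡0⇒i≡0 N>4 (proj₁ (+-nonneg-≡0 [N-3][N-4]σ≥0 spectral-bound (proj₁ parts))))
        open Regular s≗0
        excess≡0 : ∀ u v → excess u v ≡ 0ℤ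
        excess≡0 u v = ∑-nonneg-≡0 (λ b → excess b v) (λ b → excess≥0 b v)
          (∑-nonneg-≡0 (λ a → ∑[ b < n ] excess b a) (λ a → ∑-nonneg (λ b → excess b a) (λ b → excess≥0 b a))
            (trans ∑excess (k*i≡0⇒i≡0 {+ 2} (+<+ (ℕ.s≤s ℕ.z≤n)) (proj₂ parts))) v) u
        S²≡1 : ∀ u v → ¬ u ≡ v → S² u v ≡ 1ℤ
        S²≡1 u v u≢v = sym (i-j≡0⇒i≡j 1ℤ (S² u v) (trans (sym (slack-off u v u≢v))
          (∑-nonneg-≡0 (slack u) (λ w → slack≥0 u w (excess≡0 u w)) (∑slack≡0 u) v)))

open import Defs
open import Data.Nat using (ℕ; _+_; _*_; _∸_; _≤_; _%_)
open import Data.Product using (_×_)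
open import Function.Bundles using (_⇔_)
open import Relation.Binary.PropositionalEquality using (_≡_)

import Data.Nat as ℕ
open import Data.Nat.DivMod using (_/_; m≡m%n+[m/n]*n)
import Data.Integer as ℤ
open import Data.Integer using (+_; 0ℤ; 1ℤ; nonNegative)
open import Data.Integer.Properties using (pos-+; pos-*; *-comm; +-injective; drop‿+≤+; i-j≤i; +-identityʳ)
open import Data.Product using (_,_)
open import Function.Base using (_∘_)
open import Function.Bundles using (mk⇔)
open import Relation.Binary.PropositionalEquality using (sym; trans; cong; subst)
open FiniteSums
open CountingIdentity
open EqualityCase

pos-*⁵ : ∀ a b c d e → + (a * b * c * d * e) ≡ + a ℤ.* + b ℤ.* + c ℤ.* + d ℤ.* + e
pos-*⁵ a b c d e =
  trans (pos-* (a * b * c * d) e) (cong (ℤ._* + e) (trans (pos-* (a * b * c) d) (cong (ℤ._* + d)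
    (trans (pos-* (a * b) c) (cong (ℤ._* + c) (pos-* a b))))))

odd⇒≡1+2k : ∀ {n} → n % 2 ≡ 1 → + n ≡ 1ℤ ℤ.+ + 2 ℤ.* + (n / 2)
odd⇒≡1+2k {n} n%2≡1 =
  trans (cong +_ (trans (m≡m%n+[m/n]*n n 2) (cong (_+ (n / 2) * 2) n%2≡1)))
    (trans (pos-+ 1 ((n / 2) * 2)) (cong (ℤ._+_ 1ℤ) (trans (pos-* (n / 2) 2) (*-comm (+ (n / 2)) (+ 2)))))

theorem1 : (n : ℕ) → 5 ≤ n → n % 2 ≡ 1 → (T : Tournament n) →
    (c5 T * 160 ≤ (n + 1) * n * (n ∸ 1) * (n ∸ 2) * (n ∸ 3))
    × (c5 T * 160 ≡ (n + 1) * n * (n ∸ 1) * (n ∸ 2) * (n ∸ 3) ⇔ IsDoublyRegular T)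
theorem1 n (ℕ.s≤s (ℕ.s≤s (ℕ.s≤s (ℕ.s≤s (ℕ.s≤s _))))) n-odd T =
  drop‿+≤+ (subst (ℤ._≤ + bound) (sym c5-identity) (i-j≤i (+ bound) (+ 5 ℤ.* defect) {{nonNegative 5defect≥0}})) ,
  mk⇔ (defect≡0⇒doublyRegular N>4 ∘ extremal⇒defect≡0) (+-injective ∘ doublyRegular⇒extremal)
  where
  open TournamentMatrix T
  open Defect T
  open OddDefect (+ (n / 2)) (odd⇒≡1+2k n-odd)
  bound : ℕ
  bound = (n + 1) * n * (n ∸ 1) * (n ∸ 2) * (n ∸ 3)
  -- With n matched as 5 + m, the product evaluates to a positive numeral.
  N>4 : 0ℤ ℤ.< (N ℤ.- + 3) ℤ.* (N ℤ.- + 4)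
  N>4 = ℤ.+<+ (ℕ.s≤s ℕ.z≤n)
  c5-identity : + (c5 T * 160) ≡ + bound ℤ.- + 5 ℤ.* defect
  c5-identity = trans (pos-* (c5 T) 160) (trans (*-comm (+ c5 T) (+ 160))
                  (trans 160c₅≡ (cong (ℤ._- + 5 ℤ.* defect) (sym (pos-*⁵ (n + 1) n (n ∸ 1) (n ∸ 2) (n ∸ 3))))))
  5defect≥0 : 0ℤ ℤ.≤ + 5 ℤ.* defect
  5defect≥0 = *-nonneg {+ 5} (ℤ.+≤+ ℕ.z≤n) defect≥0
  extremal⇒defect≡0 : c5 T * 160 ≡ bound → defect ≡ 0ℤ
  extremal⇒defect≡0 extremal =
    k*i≡0⇒i≡0 {+ 5} (ℤ.+<+ (ℕ.s≤s ℕ.z≤n)) (i-j≡i⇒j≡0 (trans (sym c5-identity) (cong +_ extremal)))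
  doublyRegular⇒extremal : IsDoublyRegular T → + (c5 T * 160) ≡ + bound
  doublyRegular⇒extremal dr =
    trans c5-identity (trans (cong (λ d → + bound ℤ.- + 5 ℤ.* d) (doublyRegular⇒defect≡0 dr)) (+-identityʳ (+ bound)))
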